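{- For all integers $m\ge0$ and $r\ge0$, $$\langle W|\mathsf d^{m+r}|V^r\rangle=\begin{bmatrix}m+r\\ r\end{bmatrix}_q\frac{F_m(bdq^r)}{\prod_{i=0}^{m-1}(1-abcdq^{2r+i})},$$ where $F_m(y)$ is defined by $F_0(y)=1$, $F_m(y)=0$ for $m<0$, and $F_m(y)=\big(b+d-y(a+c)q^{m-1}\big)F_{m-1}(y)+(q^{m-1}-1)\big(bd-acq^{m-2}y^2\big)F_{m-2}(y)$ for $m>0$.
   Context: Fix generic complex parameters $a,b,c,d,q$. For integers $n\ge0$ define $\mathcal{A}_n=\frac{(1-q^{n-1}abcd)(1-q^{n+1})(1-q^nab)(1-q^nac)(1-q^nad)(1-q^nbc)(1-q^nbd)(1-q^ncd)}{(1-q^{2n-1}abcd)(1-q^{2n}abcd)^2(1-q^{2n+1}abcd)}$, $d_n^\natural=\frac{q^{n-1}}{(1-q^{2n-2}abcd)(1-q^{2n}abcd)}\big[bd(a+c)+(b+d)q-abcd(b+d)q^{n-1}-\{bd(a+c)+abcd(b+d)\}q^n-bd(a+c)q^{n+1}+ab^2cd^2(a+c)q^{2n-1}+abcd(b+d)q^{2n}\big]$, $d_n^\sharp=1$, $d_n^\flat=-\frac{q^nbd}{(1-q^nac)(1-q^nbd)}\mathcal{A}_n$. Let $\mathsf d$ be the infinite tridiagonal matrix indexed by $\{0,1,\dots\}$ with nonzero entries $\mathsf d_{n,n}=d_n^\natural$, $\mathsf d_{n,n+1}=d_n^\sharp$, $\mathsf d_{n+1,n}=d_n^\flat$. Let $\langle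 W|=(1,0,0,\dots)$ and $|V^r\rangle$ the column vector with $1$ in position $r$ (positions indexed from $0$) and $0$ elsewhere. The $q$-binomial coefficient is $\begin{bmatrix}N\\ r\end{bmatrix}_q=\frac{[N]_q!}{[r]_q![N-r]_q!}$ with $[k]_q!=\prod_{j=1}^k(1+q+\dots+q^{j-1})$. -}

module Defs where

open import Level using (Level; _⊔_) renaming (suc to lsuc)
open import Algebra.Bundles using (CommutativeRing)
open import Data.Nat using (ℕ; zero; suc; _≟_) renaming (_+_ to _+ℕ_; _*_ to _*ℕ_; _∸_ to _∸ℕ_)
open import Data.Integer using (ℤ; +_; -[1+_]) renaming (_-_ to _-ℤ_; _+_ to _+ℤ_)
open import Relation.Nullary using (¬_; yes; no)

-- A field (abstracting the complex numbers ℂ, which agda-stdlib lacks):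
-- a commutative ring with 1 ≠ 0, a (total) function inv that is a
-- multiplicative inverse on nonzero elements, and characteristic zero.
-- n · 1 in a commutative ring
ringFromℕ : ∀ {c ℓ} (R : CommutativeRing c ℓ) → ℕ → CommutativeRing.Carrier R
ringFromℕ R zero    = CommutativeRing.0# R
ringFromℕ R (suc n) = CommutativeRing._+_ R (CommutativeRing.1# R) (ringFromℕ R n)

record Field (c ℓ : Level) : Set (lsuc (c ⊔ ℓ)) where
  field
    commutativeRing : CommutativeRing c ℓ
  open CommutativeRing commutativeRing public
  field
    inv        : Carrier → Carrier
    inv-cong   : ∀ {x y} → x ≈ y → inv x ≈ inv y
    inverse    : ∀ x → ¬ (x ≈ 0#) → x * inv x ≈ 1#
    nontrivial : ¬ (1# ≈ 0#)
    char-zero  : ∀ n → ¬ (ringFromℕ commutativeRing (suc n) ≈ 0#)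

module Setup {c ℓ : Level} (K : Field c ℓ) (a b c d q : Field.Carrier K) where
  open Field K hiding (zero)

  infixl 6 _−_
  infixl 7 _/_
  _−_ : Carrier → Carrier → Carrier
  x − y = x + (- y)

  _/_ : Carrier → Carrier → Carrier
  x / y = x * inv y

  pow : Carrier → ℕ → Carrier
  pow x zero    = 1#
  pow x (suc n) = x * pow x n

  qpow : ℤ → Carrier
  qpow (+ n)     = pow q n
  qpow -[1+ n ]  = pow (inv q) (suc n)

  qn : ℕ → Carrier
  qn n = qpow (+ n)

  abcd : Carrier
  abcd = a * b * c * d

  sumTo : ℕ → (ℕ → Carrier) → Carrier
  sumTo zero    f = 0#
  sumTo (suc n) f = sumTo n f + f n

  prodTo : ℕ → (ℕ → Carrier) → Carrier
  prodTo zero    f = 1#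
  prodTo (suc n) f = prodTo n f * f n

  𝒜 : ℕ → Carrier
  𝒜 n =
    ((1# − qpow (+ n -ℤ + 1) * abcd) * (1# − qn (suc n)) * (1# − qn n * (a * b))
      * (1# − qn n * (a * c)) * (1# − qn n * (a * d)) * (1# − qn n * (b * c))
      * (1# − qn n * (b * d)) * (1# − qn n * (c * d)))
    / ((1# − qpow (+ (2 *ℕ n) -ℤ + 1) * abcd) * pow (1# − qn (2 *ℕ n) * abcd) 2
       * (1# − qn (2 *ℕ n +ℕ 1) * abcd))

  d♮ : ℕ → Carrier
  d♮ n =
    (qpow (+ n -ℤ + 1) / ((1# − qpow (+ (2 *ℕ n) -ℤ + 2) * abcd) * (1# − qn (2 *ℕ n) * abcd)))
    * ( b * d * (a + c) + (b + d) * q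
        − abcd * (b + d) * qpow (+ n -ℤ + 1)
        − (b * d * (a + c) + abcd * (b + d)) * qn n
        − b * d * (a + c) * qn (suc n)
        + a * pow b 2 * c * pow d 2 * (a + c) * qpow (+ (2 *ℕ n) -ℤ + 1)
        + abcd * (b + d) * qn (2 *ℕ n) )

  d♯ : ℕ → Carrier
  d♯ n = 1#

  d♭ : ℕ → Carrier
  d♭ n = - ((qn n * (b * d)) / ((1# − qn n * (a * c)) * (1# − qn n * (b * d)))) * 𝒜 n

  𝖽 : ℕ → ℕ → Carrier
  𝖽 i j with i ≟ j
  ... | yes _ = d♮ i
  ... | no _ with j ≟ suc i
  ...   | yes _ = d♯ i
  ...   | no _ with i ≟ suc j
  ...     | yes _ = d♭ j
  ...     | no _  = 0#

  𝟙 : ℕ → ℕ → Carrier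
  𝟙 i j with i ≟ j
  ... | yes _ = 1#
  ... | no _  = 0#

  -- Column j of 𝖽 is zero outside
  -- rows k ≤ j+1, so the (a priori infinite) sum over k is the finite
  -- sum over k < j+2 below: this is the exact matrix product.
  𝖽^ : ℕ → ℕ → ℕ → Carrier
  𝖽^ zero    i j = 𝟙 i j
  𝖽^ (suc N) i j = sumTo (suc (suc j)) (λ k → 𝖽^ N i k * 𝖽 k j)

  -- ⟨W| 𝖽^N |V^r⟩ with ⟨W| = (1,0,0,…) and |V^r⟩ the r-th unit column
  -- vector: this is the (0, r) entry of 𝖽^N.
  ⟨W|𝖽^_|V^_⟩ : ℕ → ℕ → Carrier
  ⟨W|𝖽^ N |V^ r ⟩ = 𝖽^ N 0 r

  [_]q : ℕ → Carrier
  [ k ]q = sumTo k (λ j → pow q j)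

  [_]q! : ℕ → Carrier
  [ k ]q! = prodTo k (λ j → [ suc j ]q)

  qbinom : ℕ → ℕ → Carrier
  qbinom N r = [ N ]q! / ([ r ]q! * [ N ∸ℕ r ]q!)

  F : ℕ → Carrier → Carrier
  F zero y = 1#
  F (suc zero) y =
    (b + d − y * (a + c) * qpow (+ 0)) * F zero y
    + (qpow (+ 0) − 1#) * (b * d − a * c * qpow (-[1+ 0 ]) * pow y 2) * 0#
  F (suc (suc m)) y =
    (b + d − y * (a + c) * qn (suc m)) * F (suc m) y
    + (qn (suc m) − 1#) * (b * d − a * c * qn m * pow y 2) * F m y

  record Generic : Set ℓ where
    field
      q≠0      : ¬ (q ≈ 0#)
      abcd≠    : ∀ (k : ℤ) → ¬ (1# − qpow k * abcd ≈ 0#)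
      ac≠      : ∀ (n : ℕ) → ¬ (1# − qn n * (a * c) ≈ 0#)
      bd≠      : ∀ (n : ℕ) → ¬ (1# − qn n * (b * d) ≈ 0#)
      [k]q≠0   : ∀ (k : ℕ) → ¬ ([ suc k ]q ≈ 0#)

-- Write Lᴺ r for ⟨W| 𝖽ᴺ |Vʳ⟩.  Since 𝖽 is tridiagonal with ones above the diagonal, Lᴺ r = 0 for
-- r > N, Lᴺ N = 1 and L^(N+1) r = Lᴺ (r-1) + Lᴺ r · d♮ r + Lᴺ (r+1) · d♭ r, so it suffices that the
-- closed form R m r obeys R (m+1) r = R (m+1) (r-1) + R m r · d♮ r + R (m-1) (r+1) · d♭ r.  The four
-- terms share the factor [m+r]! / ([r]! [m]! ∏ᵢ (1 - abcd q^(2r+i))); without it, and with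
-- denominators cleared, the recurrence is a polynomial identity in v = q^(r-1), t = qᵐ and the values
-- of F m and F (m-1) at b d qʳ.  The other values of F are reduced to these by the recurrence of F,
-- by its shifted form F (m+1) y = (b+d-(a+c)y) F m (q y) + (qᵐ-1)(bd-ac y²) F (m-1) (q y), and by a
-- contiguous relation for F (m-1) (b d q^(r+1)).  The q-integers are related by
-- [r] (1 - q^(m+1)) = [m+1] (1 - qʳ); as q = 1 is allowed, 1 - q^(m+1) is never inverted: the
-- coefficient of [r] is divided by it explicitly.
module Submission where

open import Defs
open import Level using (Level)
open import Algebra.Bundles using (CommutativeRing; RawRing)
open import Data.Bool using (Bool; true; false; T)
open import Data.Empty using (⊥-elim)
open import Data.Fin using (#_)
open import Data.Integer as ℤ using (ℤ; +_; -[1+_]; _⊖_; 0ℤ; 1ℤ)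
import Data.Integer.Properties as ℤ
open import Data.Maybe using (nothing)
open import Data.Nat as ℕ using (ℕ; zero; suc; _∸_; _≟_; _<_; _≤_; s≤s)
  renaming (_+_ to _+ℕ_; _*_ to _*ℕ_)
import Data.Nat.Properties as ℕ
open import Data.Vec using (Vec)
open import Data.Vec.Relation.Binary.Pointwise.Inductive using (Pointwise; lookup; []; _∷_)
open import Relation.Binary.PropositionalEquality as ≡ using (_≡_)
open import Relation.Nullary using (¬_; yes; no)
import Tactic.RingSolver.Core.AlmostCommutativeRing as ACR
open import Tactic.RingSolver.Core.Expression using (Expr; Κ; Ι; _⊕_; _⊗_; ⊝_; _⊛_; module Eval)
open import Tactic.RingSolver.Core.Polynomial.Parameters using (Homomorphism)

-- The library's ring solvers take their coefficients from the ring itself and must decide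
-- when a coefficient vanishes, which a field with setoid equality cannot do.  Integer
-- coefficients, mapped by n ↦ n · 1#, make the solver complete for every commutative ring.
module IntegerCoefficientSolver {c ℓ} (R : CommutativeRing c ℓ) where
  open CommutativeRing R
  open import Algebra.Properties.CommutativeSemigroup +-commutativeSemigroup using (interchange)
  open import Algebra.Properties.Ring ring
    using (-‿involutive; -0#≈0#; -‿distribˡ-*; -‿distribʳ-*; -‿+-comm)
  open import Algebra.Properties.Semiring.Exp.TCOptimised semiring using (^-congˡ)
  open import Algebra.Properties.Semiring.Mult.TCOptimised semiring using (_×_; ×-homo-+; ×1-homo-*; 1+×)
  open import Relation.Binary.Reasoning.Setoid setoid

  fromℕ : ℕ → Carrier
  fromℕ n = n × 1#

  ⟦_⟧ℤ : ℤ → Carrier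
  ⟦ + n ⟧ℤ      = fromℕ n
  ⟦ -[1+ n ] ⟧ℤ = - fromℕ (suc n)

  ⟦-⟧ℤ : ∀ i → ⟦ ℤ.- i ⟧ℤ ≈ - ⟦ i ⟧ℤ
  ⟦-⟧ℤ (+ zero)  = sym -0#≈0#
  ⟦-⟧ℤ (+ suc n) = refl
  ⟦-⟧ℤ -[1+ n ]  = sym (-‿involutive _)

  ⟦⊖⟧ℤ : ∀ m n → ⟦ m ⊖ n ⟧ℤ ≈ fromℕ m - fromℕ n
  ⟦⊖⟧ℤ m zero = begin
    ⟦ m ⊖ 0 ⟧ℤ     ≡⟨ ≡.cong ⟦_⟧ℤ (ℤ.⊖-≥ {m} {0} ℕ.z≤n) ⟩
    fromℕ m        ≈⟨ +-identityʳ _ ⟨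
    fromℕ m + 0#   ≈⟨ +-congˡ -0#≈0# ⟨
    fromℕ m - 0#   ∎
  ⟦⊖⟧ℤ zero (suc n) = begin
    ⟦ 0 ⊖ suc n ⟧ℤ     ≡⟨ ≡.cong ⟦_⟧ℤ (ℤ.⊖-≤ {0} {suc n} ℕ.z≤n) ⟩
    ⟦ ℤ.- + suc n ⟧ℤ   ≈⟨ +-identityˡ _ ⟨
    0# - fromℕ (suc n) ∎
  ⟦⊖⟧ℤ (suc m) (suc n) = begin
    ⟦ suc m ⊖ suc n ⟧ℤ                 ≡⟨ ≡.cong ⟦_⟧ℤ (ℤ.[1+m]⊖[1+n]≡m⊖n m n) ⟩
    ⟦ m ⊖ n ⟧ℤ                         ≈⟨ ⟦⊖⟧ℤ m n ⟩
    fromℕ m - fromℕ n                  ≈⟨ +-identityˡ _ ⟨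
    0# + (fromℕ m - fromℕ n)           ≈⟨ +-congʳ (-‿inverseʳ 1#) ⟨
    (1# - 1#) + (fromℕ m - fromℕ n)    ≈⟨ interchange 1# (- 1#) (fromℕ m) (- fromℕ n) ⟩
    (1# + fromℕ m) + (- 1# - fromℕ n)  ≈⟨ +-congˡ (-‿+-comm 1# (fromℕ n)) ⟩
    (1# + fromℕ m) - (1# + fromℕ n)    ≈⟨ +-cong (1+× m 1#) (-‿cong (1+× n 1#)) ⟨
    fromℕ (suc m) - fromℕ (suc n)      ∎

  ⟦+⟧ℤ : ∀ i j → ⟦ i ℤ.+ j ⟧ℤ ≈ ⟦ i ⟧ℤ + ⟦ j ⟧ℤ
  ⟦+⟧ℤ (+ m)    (+ n)    = ×-homo-+ 1# m n
  ⟦+⟧ℤ (+ m)    -[1+ n ] = ⟦⊖⟧ℤ m (suc n)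
  ⟦+⟧ℤ -[1+ m ] (+ n)    = trans (⟦⊖⟧ℤ n (suc m)) (+-comm _ _)
  ⟦+⟧ℤ -[1+ m ] -[1+ n ] = begin
    - fromℕ (suc (suc (m +ℕ n)))       ≡⟨ ≡.cong (λ k → - fromℕ (suc k)) (ℕ.+-suc m n) ⟨
    - fromℕ (suc m +ℕ suc n)           ≈⟨ -‿cong (×-homo-+ 1# (suc m) (suc n)) ⟩
    - (fromℕ (suc m) + fromℕ (suc n))  ≈⟨ -‿+-comm _ _ ⟨
    - fromℕ (suc m) + - fromℕ (suc n)  ∎

  ⟦*⟧ℤ : ∀ i j → ⟦ i ℤ.* j ⟧ℤ ≈ ⟦ i ⟧ℤ * ⟦ j ⟧ℤ
  ⟦*⟧ℤ (+ m) (+ n) = begin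
    ⟦ + m ℤ.* + n ⟧ℤ  ≡⟨ ≡.cong ⟦_⟧ℤ (ℤ.+◃n≡+n (m *ℕ n)) ⟩
    fromℕ (m *ℕ n)    ≈⟨ ×1-homo-* m n ⟩
    fromℕ m * fromℕ n ∎
  ⟦*⟧ℤ (+ m) -[1+ n ] = begin
    ⟦ + m ℤ.* -[1+ n ] ⟧ℤ      ≡⟨ ≡.cong ⟦_⟧ℤ (ℤ.-◃n≡-n (m *ℕ suc n)) ⟩
    ⟦ ℤ.- + (m *ℕ suc n) ⟧ℤ    ≈⟨ ⟦-⟧ℤ (+ (m *ℕ suc n)) ⟩
    - fromℕ (m *ℕ suc n)       ≈⟨ -‿cong (×1-homo-* m (suc n)) ⟩
    - (fromℕ m * fromℕ (suc n)) ≈⟨ -‿distribʳ-* _ _ ⟩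
    fromℕ m * - fromℕ (suc n)   ∎
  ⟦*⟧ℤ -[1+ m ] (+ n) = begin
    ⟦ -[1+ m ] ℤ.* + n ⟧ℤ      ≡⟨ ≡.cong ⟦_⟧ℤ (ℤ.-◃n≡-n (suc m *ℕ n)) ⟩
    ⟦ ℤ.- + (suc m *ℕ n) ⟧ℤ    ≈⟨ ⟦-⟧ℤ (+ (suc m *ℕ n)) ⟩
    - fromℕ (suc m *ℕ n)       ≈⟨ -‿cong (×1-homo-* (suc m) n) ⟩
    - (fromℕ (suc m) * fromℕ n) ≈⟨ -‿distribˡ-* _ _ ⟩
    - fromℕ (suc m) * fromℕ n   ∎
  ⟦*⟧ℤ -[1+ m ] -[1+ n ] = begin
    fromℕ (suc m *ℕ suc n)               ≈⟨ ×1-homo-* (suc m) (suc n) ⟩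
    fromℕ (suc m) * fromℕ (suc n)        ≈⟨ -‿involutive _ ⟨
    - - (fromℕ (suc m) * fromℕ (suc n))  ≈⟨ -‿cong (-‿distribˡ-* _ _) ⟩
    - (- fromℕ (suc m) * fromℕ (suc n))  ≈⟨ -‿distribʳ-* _ _ ⟩
    - fromℕ (suc m) * - fromℕ (suc n)    ∎

  private
    isZero : ℤ → Bool
    isZero (+ zero) = true
    isZero _        = false

    isZero-sound : ∀ i → T (isZero i) → 0# ≈ ⟦ i ⟧ℤ
    isZero-sound (+ zero) _ = refl

    homomorphism : Homomorphism _ _ c ℓ
    homomorphism = record
      { from          = record { rawRing = ℤ.+-*-rawRing ; isZero = isZero }
      ; to            = ACR.fromCommutativeRing R (λ _ → nothing)
      ; morphism      = record
        { ⟦_⟧ = ⟦_⟧ℤ ; +-homo = ⟦+⟧ℤ ; *-homo = ⟦*⟧ℤ ; -‿homo = ⟦-⟧ℤ ; 0-homo = refl ; 1-homo = refl }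
      ; Zero-C⟶Zero-R = isZero-sound
      }

  open Eval rawRing ⟦_⟧ℤ public

  private
    open import Tactic.RingSolver.Core.Polynomial.Base (Homomorphism.from homomorphism)
    open import Tactic.RingSolver.Core.Polynomial.Semantics homomorphism renaming (⟦_⟧ to ⟦_⟧ₚ)
    open import Tactic.RingSolver.Core.Polynomial.Homomorphism homomorphism

    norm : ∀ {n} → Expr ℤ n → Poly n
    norm (Κ x)   = κ x
    norm (Ι x)   = ι x
    norm (x ⊕ y) = norm x ⊞ norm y
    norm (x ⊗ y) = norm x ⊠ norm y
    norm (⊝ x)   = ⊟ norm x
    norm (x ⊛ i) = norm x ⊡ i

    ⟦_⇓⟧ : ∀ {n} → Expr ℤ n → Vec Carrier n → Carrier
    ⟦ e ⇓⟧ = ⟦ norm e ⟧ₚ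

    correct : ∀ {n} (e : Expr ℤ n) ρ → ⟦ e ⇓⟧ ρ ≈ ⟦ e ⟧ ρ
    correct (Κ x)   ρ = κ-hom x ρ
    correct (Ι x)   ρ = ι-hom x ρ
    correct (x ⊕ y) ρ = trans (⊞-hom (norm x) (norm y) ρ) (+-cong (correct x ρ) (correct y ρ))
    correct (x ⊗ y) ρ = trans (⊠-hom (norm x) (norm y) ρ) (*-cong (correct x ρ) (correct y ρ))
    correct (⊝ x)   ρ = trans (⊟-hom (norm x) ρ) (-‿cong (correct x ρ))
    correct (x ⊛ i) ρ = trans (⊡-hom (norm x) i ρ) (^-congˡ i (correct x ρ))

  open import Relation.Binary.Reflection setoid Ι ⟦_⟧ ⟦_⇓⟧ correct public using (solve; _⊜_)

  ⟦⟧-cong : ∀ {n} (e : Expr ℤ n) {ρ ρ′} → Pointwise _≈_ ρ ρ′ → ⟦ e ⟧ ρ ≈ ⟦ e ⟧ ρ′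
  ⟦⟧-cong (Κ x)   p = refl
  ⟦⟧-cong (Ι i)   p = lookup p i
  ⟦⟧-cong (e ⊕ f) p = +-cong (⟦⟧-cong e p) (⟦⟧-cong f p)
  ⟦⟧-cong (e ⊗ f) p = *-cong (⟦⟧-cong e p) (⟦⟧-cong f p)
  ⟦⟧-cong (⊝ e)   p = -‿cong (⟦⟧-cong e p)
  ⟦⟧-cong (e ⊛ i) p = ^-congˡ i (⟦⟧-cong e p)

  -- A polynomial written once over an arbitrary raw ring is, at this instance, the solver's
  -- input, and at rawRing the statement it proves; ⟦_⟧ maps the former to the latter.
  syntaxRing : ℕ → RawRing _ _
  syntaxRing n = record
    { Carrier = Expr ℤ n ; _≈_ = _≡_ ; _+_ = _⊕_ ; _*_ = _⊗_ ; -_ = ⊝_ ; 0# = Κ 0ℤ ; 1# = Κ 1ℤ }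

module DividedDifference {c ℓ} (R : CommutativeRing c ℓ) where
  open CommutativeRing R
  open IntegerCoefficientSolver R
  open import Relation.Binary.Reasoning.Setoid setoid

  -- N₁ enters only through X₁ − T·X₀, which is a multiple of 1 − T; the relation
  -- N₁·(1 − T) = N₂·W then trades N₁ for N₂ without dividing by 1 − T.
  divided-difference-elimination :
    ∀ {N₀ N₁ N₂ T W X₀ X₁ A Y} →
    N₀ ≈ N₂ + T * N₁ → X₁ - T * X₀ ≈ (1# - T) * A → N₁ * (1# - T) ≈ N₂ * W → X₀ - W * A ≈ Y →
    N₀ * X₀ ≈ N₁ * X₁ + N₂ * Y
  divided-difference-elimination {N₀} {N₁} {N₂} {T} {W} {X₀} {X₁} {A} {Y} hN hX hT hY = begin
    N₀ * X₀                                   ≈⟨ *-congʳ hN ⟩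
    (N₂ + T * N₁) * X₀                        ≈⟨ solve 5 (λ N₁ N₂ T X₀ X₁ →
      (N₂ ⊕ T ⊗ N₁) ⊗ X₀ ⊜ N₁ ⊗ X₁ ⊕ N₂ ⊗ X₀ ⊕ ⊝ (N₁ ⊗ (X₁ ⊕ ⊝ (T ⊗ X₀)))) refl N₁ N₂ T X₀ X₁ ⟩
    N₁ * X₁ + N₂ * X₀ - N₁ * (X₁ - T * X₀)    ≈⟨ +-congˡ (-‿cong (*-congˡ hX)) ⟩
    N₁ * X₁ + N₂ * X₀ - N₁ * ((1# - T) * A)   ≈⟨ +-congˡ (-‿cong (trans (sym (*-assoc _ _ _)) (*-congʳ hT))) ⟩
    N₁ * X₁ + N₂ * X₀ - N₂ * W * A            ≈⟨ solve 6 (λ N₁ N₂ W X₀ X₁ A →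
      N₁ ⊗ X₁ ⊕ N₂ ⊗ X₀ ⊕ ⊝ (N₂ ⊗ W ⊗ A) ⊜ N₁ ⊗ X₁ ⊕ N₂ ⊗ (X₀ ⊕ ⊝ (W ⊗ A))) refl N₁ N₂ W X₀ X₁ A ⟩
    N₁ * X₁ + N₂ * (X₀ - W * A)               ≈⟨ +-congˡ (*-congˡ hY) ⟩
    N₁ * X₁ + N₂ * Y                          ∎

module FieldProperties {ℓ₁ ℓ₂} (K : Field ℓ₁ ℓ₂) where
  open Field K hiding (zero)
  open IntegerCoefficientSolver commutativeRing
  open import Relation.Binary.Reasoning.Setoid setoid

  _≉0 : Carrier → Set ℓ₂
  x ≉0 = ¬ (x ≈ 0#)

  ≉0-cong : ∀ {x y} → x ≈ y → x ≉0 → y ≉0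
  ≉0-cong x≈y x≉0 y≈0 = x≉0 (trans x≈y y≈0)

  *-≉0 : ∀ {x y} → x ≉0 → y ≉0 → (x * y) ≉0
  *-≉0 {x} {y} x≉0 y≉0 xy≈0 = x≉0 (begin
    x                 ≈⟨ *-identityʳ x ⟨
    x * 1#            ≈⟨ *-congˡ (inverse y y≉0) ⟨
    x * (y * inv y)   ≈⟨ *-assoc x y (inv y) ⟨
    (x * y) * inv y   ≈⟨ *-congʳ xy≈0 ⟩
    0# * inv y        ≈⟨ zeroˡ _ ⟩
    0#                ∎)

  *-inverseʳ-cancel : ∀ {y} → y ≉0 → ∀ x → x * (y * inv y) ≈ x
  *-inverseʳ-cancel y≉0 x = trans (*-congˡ (inverse _ y≉0)) (*-identityʳ x)

  inv-* : ∀ {x y} → x ≉0 → y ≉0 → inv (x * y) ≈ inv x * inv y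
  inv-* {x} {y} x≉0 y≉0 = begin
    inv (x * y)                                      ≈⟨ *-inverseʳ-cancel x≉0 _ ⟨
    inv (x * y) * (x * inv x)                        ≈⟨ *-inverseʳ-cancel y≉0 _ ⟨
    inv (x * y) * (x * inv x) * (y * inv y)
      ≈⟨ solve 5 (λ xy⁻¹ x x⁻¹ y y⁻¹ → xy⁻¹ ⊗ (x ⊗ x⁻¹) ⊗ (y ⊗ y⁻¹) ⊜ x⁻¹ ⊗ y⁻¹ ⊗ ((x ⊗ y) ⊗ xy⁻¹)) refl
           (inv (x * y)) x (inv x) y (inv y) ⟩
    inv x * inv y * ((x * y) * inv (x * y))          ≈⟨ *-inverseʳ-cancel (*-≉0 x≉0 y≉0) _ ⟩
    inv x * inv y                                    ∎

  *-cancelʳ : ∀ {x y z} → z ≉0 → x * z ≈ y * z → x ≈ y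
  *-cancelʳ {x} {y} {z} z≉0 xz≈yz = begin
    x                   ≈⟨ *-inverseʳ-cancel z≉0 x ⟨
    x * (z * inv z)     ≈⟨ *-assoc x z (inv z) ⟨
    x * z * inv z       ≈⟨ *-congʳ xz≈yz ⟩
    y * z * inv z       ≈⟨ *-assoc y z (inv z) ⟩
    y * (z * inv z)     ≈⟨ *-inverseʳ-cancel z≉0 y ⟩
    y                   ∎

  /-ratio : ∀ {x x′ u u′ p w} → u ≉0 → u′ ≉0 → w ≉0 → x * (u′ * w) ≈ x′ * p * u →
            x * inv u ≈ (x′ * inv u′) * (p * inv w)
  /-ratio {x} {x′} {u} {u′} {p} {w} u≉0 u′≉0 w≉0 cross = begin
    x * inv u
      ≈⟨ *-inverseʳ-cancel w≉0 _ ⟨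
    x * inv u * (w * inv w)
      ≈⟨ *-inverseʳ-cancel u′≉0 _ ⟨
    x * inv u * (w * inv w) * (u′ * inv u′)
      ≈⟨ solve 6 (λ x u⁻¹ w w⁻¹ u′ u′⁻¹ →
           x ⊗ u⁻¹ ⊗ (w ⊗ w⁻¹) ⊗ (u′ ⊗ u′⁻¹) ⊜ x ⊗ (u′ ⊗ w) ⊗ (u′⁻¹ ⊗ w⁻¹ ⊗ u⁻¹)) refl
           x (inv u) w (inv w) u′ (inv u′) ⟩
    x * (u′ * w) * (inv u′ * inv w * inv u)
      ≈⟨ *-congʳ cross ⟩
    x′ * p * u * (inv u′ * inv w * inv u)
      ≈⟨ solve 6 (λ x′ p u u′⁻¹ w⁻¹ u⁻¹ →
           x′ ⊗ p ⊗ u ⊗ (u′⁻¹ ⊗ w⁻¹ ⊗ u⁻¹) ⊜ (x′ ⊗ u′⁻¹) ⊗ (p ⊗ w⁻¹) ⊗ (u ⊗ u⁻¹)) refl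
           x′ p u (inv u′) (inv w) (inv u) ⟩
    (x′ * inv u′) * (p * inv w) * (u * inv u)
      ≈⟨ *-inverseʳ-cancel u≉0 _ ⟩
    (x′ * inv u′) * (p * inv w) ∎

module Polynomials {ℓ₁ ℓ₂} (R : RawRing ℓ₁ ℓ₂) (a b c d q : RawRing.Carrier R) where
  open RawRing R

  infixl 6 _−_
  _−_ : Carrier → Carrier → Carrier
  x − y = x + - y

  pow : Carrier → ℕ → Carrier
  pow x zero    = 1#
  pow x (suc n) = x * pow x n

  abcd : Carrier
  abcd = a * b * c * d

  ε : Carrier → Carrier
  ε x = 1# − x * abcd

  -- With tₖ = qᵏ the definition of F reads F (m+1) y = recᵃ tₘ y · F m y + recᵇ tₘ tₘ₋₁ y · F (m-1) y,
  -- and the shifted recurrence proved below reads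
  -- F (m+1) y = shiftᵃ y · F m (q y) + shiftᵇ tₘ y · F (m-1) (q y).
  recᵃ : Carrier → Carrier → Carrier
  recᵃ t y = b + d − y * (a + c) * t

  recᵇ : Carrier → Carrier → Carrier → Carrier
  recᵇ t w y = (t − 1#) * (b * d − a * c * w * pow y 2)

  recᵇ-at-q : Carrier → Carrier → Carrier
  recᵇ-at-q t y = (t − 1#) * (b * d − a * c * t * (q * (y * y)))

  shiftᵃ : Carrier → Carrier
  shiftᵃ y = b + d − (a + c) * y

  shiftᵇ : Carrier → Carrier → Carrier
  shiftᵇ t y = (t − 1#) * (b * d − a * c * (y * y))

  quartic : Carrier → Carrier
  quartic s = (1# − s * (a * b)) * (1# − s * (a * d)) * (1# − s * (b * c)) * (1# − s * (c * d))

  contigᵃ : Carrier → Carrier → Carrier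
  contigᵃ t s = (1# − abcd * (s * s)) * (1# − abcd * (t * (s * s)))

  contigᵇ : Carrier → Carrier
  contigᵇ s = s * (a + c − a * c * (b + d) * s)

  shift₀ˡ shift₀ʳ : (w y : Carrier) → Carrier
  shift₀ˡ w y = recᵃ 1# y * 1# + recᵇ 1# w y * 0#
  shift₀ʳ w y = shiftᵃ y * 1# + shiftᵇ 1# y * 0#

  shift₁ˡ shift₁ʳ : Carrier → Carrier
  shift₁ˡ y = recᵃ (q * 1#) y * (shiftᵃ y * 1# + shiftᵇ 1# y * 0#) + recᵇ (q * 1#) 1# y * 1#
  shift₁ʳ y = shiftᵃ y * (recᵃ 1# (q * y) * 1# + recᵇ-at-q 1# y * 0#) + shiftᵇ (q * 1#) y * 1#

  shift-stepˡ shift-stepʳ : (y t P₀ P₋ : Carrier) → Carrier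
  shift-stepˡ y t P₀ P₋ =
    recᵃ (q * (q * t)) y * (shiftᵃ y * (recᵃ t (q * y) * P₀ + recᵇ-at-q t y * P₋) + shiftᵇ (q * t) y * P₀)
    + recᵇ (q * (q * t)) (q * t) y * (shiftᵃ y * P₀ + shiftᵇ t y * P₋)
  shift-stepʳ y t P₀ P₋ =
    shiftᵃ y * (recᵃ (q * t) (q * y) * (recᵃ t (q * y) * P₀ + recᵇ-at-q t y * P₋) + recᵇ (q * t) t (q * y) * P₀)
    + shiftᵇ (q * (q * t)) y * (recᵃ t (q * y) * P₀ + recᵇ-at-q t y * P₋)

  contig₀ˡ contig₀ʳ : Carrier → Carrier
  contig₀ˡ s = quartic s * 1#
  contig₀ʳ s = contigᵃ 1# s * 1# − contigᵇ s * (shiftᵃ (b * d * s) * 1# + shiftᵇ 1# (b * d * s) * 0#)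

  contig-stepˡ contig-stepʳ : (s t P₀ P₋ : Carrier) → Carrier
  contig-stepˡ s t P₀ P₋ = quartic s * (recᵃ t (q * (b * d * s)) * P₀ + recᵇ-at-q t (b * d * s) * P₋)
  contig-stepʳ s t P₀ P₋ =
    contigᵃ (q * t) s * (shiftᵃ (b * d * s) * P₀ + shiftᵇ t (b * d * s) * P₋)
    − contigᵇ s * (shiftᵃ (b * d * s) * (recᵃ t (q * (b * d * s)) * P₀ + recᵇ-at-q t (b * d * s) * P₋)
                   + shiftᵇ (q * t) (b * d * s) * P₀)

  -- d♮ n = q^(n-1) / (ε q^(2n-2) · ε q^(2n)) · bracket♮ q^(n-1) qⁿ q^(2n-1) q^(2n), and
  -- d♭ n = - (qⁿ b d / ac-bd qⁿ) · (𝒜num q^(n-1) (1 − q^(n+1)) qⁿ / 𝒜den q^(2n-1) q^(2n) q^(2n+1)).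
  bracket♮ : (u s u₂ s₂ : Carrier) → Carrier
  bracket♮ u s u₂ s₂ =
    b * d * (a + c) + (b + d) * q − abcd * (b + d) * u − (b * d * (a + c) + abcd * (b + d)) * s
    − b * d * (a + c) * (q * s) + a * pow b 2 * c * pow d 2 * (a + c) * u₂ + abcd * (b + d) * s₂

  𝒜num : (u z s : Carrier) → Carrier
  𝒜num u z s = ε u * z * (1# − s * (a * b)) * (1# − s * (a * c)) * (1# − s * (a * d))
               * (1# − s * (b * c)) * (1# − s * (b * d)) * (1# − s * (c * d))

  𝒜den : (u₂ s₂ s₂₁ : Carrier) → Carrier
  𝒜den u₂ s₂ s₂₁ = ε u₂ * pow (ε s₂) 2 * ε s₂₁

  ac-bd : Carrier → Carrier
  ac-bd s = (1# − s * (a * c)) * (1# − s * (b * d))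

  -- The local identity in the variables v = q^(r-1), t = qᵐ, P = F m (b d qʳ), Q = F (m-1) (b d qʳ):
  -- after clearing denominators, ρ, ρ♯, ρ♮ and ρ♭ contribute [m+r+1]·X₀, [r]·X₁, [m+1]·X₂ and
  -- [m+1]·(1 − t)·X₃.
  Fzᶠ Fyᶠ : (v t P Q : Carrier) → Carrier
  Fzᶠ v t P Q = recᵃ t (q * (b * d * v)) * P + recᵇ-at-q t (b * d * v) * Q
  Fyᶠ v t P Q = shiftᵃ (b * d * v) * P + shiftᵇ t (b * d * v) * Q

  X₀ X₁ X₃ : (v t P Q : Carrier) → Carrier
  X₀ v t P Q = Fzᶠ v t P Q * (ε (v * v) * ε (q * v * v) * ε (q * v * (q * v)))
  X₁ v t P Q = ε (q * v * v * t) * Fyᶠ v t P Q * (ε (q * v * (q * v) * t) * ε (q * v * (q * v)))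
  X₃ v t P Q = q * v * (b * d) * ε v * ε (v * v)
               * (contigᵇ (q * v) * P − ε (q * v * (q * v)) * ε (q * v * v * t) * Q)

  X₂ : (v t P : Carrier) → Carrier
  X₂ v t P = P * v * bracket♮ v (q * v) (q * v * v) (q * v * (q * v))
             * (ε (q * v * (q * v) * t) * ε (q * v * v))

  -- (X₁ − q t X₀) / (1 − q t), computed factor by factor: with f T = ε (v² T) · ε (q v² T) and
  -- L T = x − y T, one has T · f 1 · L T − f T · L 1 = (T − 1) · g x y.
  quotient : (v t P Q : Carrier) → Carrier
  quotient v t P Q =
    ε (q * v * (q * v)) * (P * g (b + d) (b * d * (a + c) * v)
                          + (t − 1#) * Q * g (b * d) (a * c * (b * d) * (b * d) * (v * v)))
    where
    g : Carrier → Carrier → Carrier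
    g x y = ε (v * v) * ε (q * v * v) * (x − y * (q * t + 1#))
            + (x − y) * (abcd * (v * v) * (1# + q) − abcd * abcd * q * (v * v) * (v * v) * (q * t + 1#))

module PolynomialIdentities {c ℓ} (R : CommutativeRing c ℓ) (a b c d q : CommutativeRing.Carrier R) where
  open CommutativeRing R
  open IntegerCoefficientSolver R
  open Polynomials rawRing a b c d q

  recᵇ-at-q-correct : ∀ w y → recᵇ (q * w) w (q * y) ≈ recᵇ-at-q (q * w) y
  recᵇ-at-q-correct = solve 7 (λ a b c d q w y → let module S = Polynomials (syntaxRing 7) a b c d q in
    S.recᵇ (q ⊗ w) w (q ⊗ y) ⊜ S.recᵇ-at-q (q ⊗ w) y) refl a b c d q

  shift₀ : ∀ w y → shift₀ˡ w y ≈ shift₀ʳ w y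
  shift₀ = solve 7 (λ a b c d q w y → let module S = Polynomials (syntaxRing 7) a b c d q in
    S.shift₀ˡ w y ⊜ S.shift₀ʳ w y) refl a b c d q

  shift₁ : ∀ y → shift₁ˡ y ≈ shift₁ʳ y
  shift₁ = solve 6 (λ a b c d q y → let module S = Polynomials (syntaxRing 6) a b c d q in
    S.shift₁ˡ y ⊜ S.shift₁ʳ y) refl a b c d q

  shift-step : ∀ y t P₀ P₋ → shift-stepˡ y t P₀ P₋ ≈ shift-stepʳ y t P₀ P₋
  shift-step = solve 9 (λ a b c d q y t P₀ P₋ → let module S = Polynomials (syntaxRing 9) a b c d q in
    S.shift-stepˡ y t P₀ P₋ ⊜ S.shift-stepʳ y t P₀ P₋) refl a b c d q

  contig₀ : ∀ s → contig₀ˡ s ≈ contig₀ʳ s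
  contig₀ = solve 6 (λ a b c d q s → let module S = Polynomials (syntaxRing 6) a b c d q in
    S.contig₀ˡ s ⊜ S.contig₀ʳ s) refl a b c d q

  contig-step : ∀ s t P₀ P₋ → contig-stepˡ s t P₀ P₋ ≈ contig-stepʳ s t P₀ P₋
  contig-step = solve 9 (λ a b c d q s t P₀ P₋ → let module S = Polynomials (syntaxRing 9) a b c d q in
    S.contig-stepˡ s t P₀ P₋ ⊜ S.contig-stepʳ s t P₀ P₋) refl a b c d q

  quotient-spec : ∀ v t P Q → X₁ v t P Q − q * t * X₀ v t P Q ≈ (1# − q * t) * quotient v t P Q
  quotient-spec = solve 9 (λ a b c d q v t P Q → let module S = Polynomials (syntaxRing 9) a b c d q in
    S.X₁ v t P Q ⊕ ⊝ (q ⊗ t ⊗ S.X₀ v t P Q) ⊜ (Κ 1ℤ ⊕ ⊝ (q ⊗ t)) ⊗ S.quotient v t P Q)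
    refl a b c d q

  quotient-residue : ∀ v t P Q →
                     X₀ v t P Q − (1# − q * v) * quotient v t P Q ≈ X₂ v t P + (1# − t) * X₃ v t P Q
  quotient-residue = solve 9 (λ a b c d q v t P Q → let module S = Polynomials (syntaxRing 9) a b c d q in
    S.X₀ v t P Q ⊕ ⊝ ((Κ 1ℤ ⊕ ⊝ (q ⊗ v)) ⊗ S.quotient v t P Q) ⊜ S.X₂ v t P ⊕ (Κ 1ℤ ⊕ ⊝ t) ⊗ S.X₃ v t P Q)
    refl a b c d q

  bracket♮-cong : ∀ {u s s′ u₂ u₂′ s₂ s₂′} → s ≈ s′ → u₂ ≈ u₂′ → s₂ ≈ s₂′ →
                  bracket♮ u s u₂ s₂ ≈ bracket♮ u s′ u₂′ s₂′
  bracket♮-cong s≈ u₂≈ s₂≈ =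
    ⟦⟧-cong (S.bracket♮ (Ι (# 5)) (Ι (# 6)) (Ι (# 7)) (Ι (# 8)))
            (refl ∷ refl ∷ refl ∷ refl ∷ refl ∷ refl ∷ s≈ ∷ u₂≈ ∷ s₂≈ ∷ [])
    where module S = Polynomials (syntaxRing 9) (Ι (# 0)) (Ι (# 1)) (Ι (# 2)) (Ι (# 3)) (Ι (# 4))

  ε-cong : ∀ {x y} → x ≈ y → ε x ≈ ε y
  ε-cong x≈y = +-congˡ (-‿cong (*-congʳ x≈y))

  ac-bd-cong : ∀ {s s′} → s ≈ s′ → ac-bd s ≈ ac-bd s′
  ac-bd-cong s≈ = ⟦⟧-cong (S.ac-bd (Ι (# 5))) (refl ∷ refl ∷ refl ∷ refl ∷ refl {q} ∷ s≈ ∷ [])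
    where module S = Polynomials (syntaxRing 6) (Ι (# 0)) (Ι (# 1)) (Ι (# 2)) (Ι (# 3)) (Ι (# 4))

  𝒜num-cong : ∀ {u z z′ s s′} → z ≈ z′ → s ≈ s′ → 𝒜num u z s ≈ 𝒜num u z′ s′
  𝒜num-cong z≈ s≈ =
    ⟦⟧-cong (S.𝒜num (Ι (# 5)) (Ι (# 6)) (Ι (# 7)))
            (refl ∷ refl ∷ refl ∷ refl ∷ refl {q} ∷ refl ∷ z≈ ∷ s≈ ∷ [])
    where module S = Polynomials (syntaxRing 8) (Ι (# 0)) (Ι (# 1)) (Ι (# 2)) (Ι (# 3)) (Ι (# 4))

  𝒜den-cong : ∀ {u₂ u₂′ s₂ s₂′ s₂₁ s₂₁′} → u₂ ≈ u₂′ → s₂ ≈ s₂′ → s₂₁ ≈ s₂₁′ →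
              𝒜den u₂ s₂ s₂₁ ≈ 𝒜den u₂′ s₂′ s₂₁′
  𝒜den-cong u₂≈ s₂≈ s₂₁≈ =
    *-cong (*-cong (ε-cong u₂≈) (*-cong (ε-cong s₂≈) (*-congʳ (ε-cong s₂≈)))) (ε-cong s₂₁≈)

module Development {ℓ₁ ℓ₂} (K : Field ℓ₁ ℓ₂) (a b c d q : Field.Carrier K)
                   (generic : Setup.Generic K a b c d q) where
  open Field K hiding (zero)
  open Setup K a b c d q
  open Setup.Generic generic
  open FieldProperties K
  open IntegerCoefficientSolver commutativeRing using (solve; _⊜_)
  open DividedDifference commutativeRing using (divided-difference-elimination)
  open Polynomials rawRing a b c d q
    using (ε; recᵃ; recᵇ; recᵇ-at-q; shiftᵃ; shiftᵇ; quartic; contigᵃ; contigᵇ;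
           bracket♮; 𝒜num; 𝒜den; ac-bd; X₀; X₁; X₂; X₃)
  open PolynomialIdentities commutativeRing a b c d q
  open import Relation.Binary.Reasoning.Setoid setoid

  -- The polynomials F

  qⁿ⁻¹ : ℕ → Carrier
  qⁿ⁻¹ n = qpow (+ n ℤ.- + 1)

  -- F₋ m is the paper's F_(m-1), with F_(-1) = 0.
  F₋ : ℕ → Carrier → Carrier
  F₋ zero    y = 0#
  F₋ (suc m) y = F m y

  F-suc : ∀ m y → F (suc m) y ≡ recᵃ (qn m) y * F m y + recᵇ (qn m) (qⁿ⁻¹ m) y * F₋ m y
  F-suc zero    y = ≡.refl
  F-suc (suc m) y = ≡.refl

  F-cong  : ∀ m {y y′} → y ≈ y′ → F m y ≈ F m y′
  F₋-cong : ∀ m {y y′} → y ≈ y′ → F₋ m y ≈ F₋ m y′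
  F-cong zero    y≈y′ = refl
  F-cong (suc m) {y} {y′} y≈y′ = begin
    F (suc m) y                                                   ≡⟨ F-suc m y ⟩
    recᵃ (qn m) y * F m y + recᵇ (qn m) (qⁿ⁻¹ m) y * F₋ m y
      ≈⟨ +-cong (*-cong (+-congˡ (-‿cong (*-congʳ (*-congʳ y≈y′)))) (F-cong m y≈y′))
                (*-cong (*-congˡ (+-congˡ (-‿cong (*-congˡ (*-cong y≈y′ (*-congʳ y≈y′))))))
                        (F₋-cong m y≈y′)) ⟩
    recᵃ (qn m) y′ * F m y′ + recᵇ (qn m) (qⁿ⁻¹ m) y′ * F₋ m y′   ≡⟨ F-suc m y′ ⟨
    F (suc m) y′                                                  ∎
  F₋-cong zero    y≈y′ = refl
  F₋-cong (suc m) y≈y′ = F-cong m y≈y′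

  -- At the point q y the coefficient q^(m-1) (q y)² becomes qᵐ q y², so no q⁻¹ is left.
  F-suc-at-q : ∀ m y →
    F (suc m) (q * y) ≈ recᵃ (qn m) (q * y) * F m (q * y) + recᵇ-at-q (qn m) y * F₋ m (q * y)
  F-suc-at-q zero    y = +-congˡ (trans (zeroʳ _) (sym (zeroʳ _)))
  F-suc-at-q (suc m) y = +-congˡ (*-congʳ (recᵇ-at-q-correct (qn m) y))

  F-shift : ∀ m y → F (suc m) y ≈ shiftᵃ y * F m (q * y) + shiftᵇ (qn m) y * F₋ m (q * y)
  F-shift zero          y = shift₀ (qpow -[1+ 0 ]) y
  F-shift (suc zero)    y = begin
    F 2 y                                                   ≈⟨ +-congʳ (*-congˡ (F-shift 0 y)) ⟩
    _                                                       ≈⟨ shift₁ y ⟩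
    _                                                       ≈⟨ +-congʳ (*-congˡ (F-suc-at-q 0 y)) ⟨
    shiftᵃ y * F 1 (q * y) + shiftᵇ (qn 1) y * F 0 (q * y)  ∎
  F-shift (suc (suc m)) y = begin
    F (3 +ℕ m) y
      ≈⟨ +-cong (*-congˡ (trans (F-shift (suc m) y) (+-congʳ (*-congˡ (F-suc-at-q m y)))))
                (*-congˡ (F-shift m y)) ⟩
    _ ≈⟨ shift-step y (qn m) (F m (q * y)) (F₋ m (q * y)) ⟩
    _ ≈⟨ +-cong (*-congˡ (+-congʳ (*-congˡ (F-suc-at-q m y)))) (*-congˡ (F-suc-at-q m y)) ⟨
    shiftᵃ y * F (2 +ℕ m) (q * y) + shiftᵇ (qn (2 +ℕ m)) y * F (suc m) (q * y) ∎

  F-contiguous : ∀ k s → quartic s * F k (q * (b * d * s))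
                         ≈ contigᵃ (qn k) s * F k (b * d * s) − contigᵇ s * F (suc k) (b * d * s)
  F-contiguous zero    s = trans (contig₀ s) (+-congˡ (-‿cong (*-congˡ (sym (F-shift 0 (b * d * s))))))
  F-contiguous (suc k) s = begin
    quartic s * F (suc k) (q * y)  ≈⟨ *-congˡ (F-suc-at-q k y) ⟩
    _                              ≈⟨ contig-step s (qn k) (F k (q * y)) (F₋ k (q * y)) ⟩
    _ ≈⟨ +-cong (*-congˡ (F-shift k y))
                (-‿cong (*-congˡ (trans (F-shift (suc k) y) (+-congʳ (*-congˡ (F-suc-at-q k y)))))) ⟨
    contigᵃ (qn (suc k)) s * F (suc k) y − contigᵇ s * F (2 +ℕ k) y   ∎
    where y = b * d * s

  F-contiguous-at : ∀ k s {y} → y ≈ b * d * s →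
                    quartic s * F k (q * y) ≈ contigᵃ (qn k) s * F k y − contigᵇ s * F (suc k) y
  F-contiguous-at k s y≈ = begin
    quartic s * F k (q * _)            ≈⟨ *-congˡ (F-cong k (*-congˡ y≈)) ⟩
    quartic s * F k (q * (b * d * s))  ≈⟨ F-contiguous k s ⟩
    _                                  ≈⟨ +-cong (*-congˡ (F-cong k (sym y≈)))
                                                 (-‿cong (*-congˡ (F-cong (suc k) (sym y≈)))) ⟩
    _                                  ∎

  -- Powers of q and q-integers

  q*qⁿ⁻¹ : ∀ n → q * qⁿ⁻¹ n ≈ qn n
  q*qⁿ⁻¹ zero    = trans (*-congˡ (*-identityʳ (inv q))) (inverse q q≠0)
  q*qⁿ⁻¹ (suc n) = refl

  pow-+ : ∀ x m n → pow x (m +ℕ n) ≈ pow x m * pow x n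
  pow-+ x zero    n = sym (*-identityˡ _)
  pow-+ x (suc m) n = trans (*-congˡ (pow-+ x m n)) (sym (*-assoc _ _ _))

  qⁿ-2n : ∀ n → qn (2 *ℕ n) ≈ qn n * qn n
  qⁿ-2n n = trans (pow-+ q n (n +ℕ 0)) (*-congˡ (trans (pow-+ q n 0) (*-identityʳ _)))

  qⁿ-2n+i : ∀ n i → qn (2 *ℕ n +ℕ i) ≈ qn n * qn n * qn i
  qⁿ-2n+i n i = trans (pow-+ q (2 *ℕ n) i) (*-congʳ (qⁿ-2n n))

  qpow-2n-2 : ∀ n → qpow (+ (2 *ℕ n) ℤ.- + 2) ≈ qⁿ⁻¹ n * qⁿ⁻¹ n
  qpow-2n-2 zero    = solve 1 (λ q⁻¹ → q⁻¹ ⊗ (q⁻¹ ⊗ Κ 1ℤ) ⊜ (q⁻¹ ⊗ Κ 1ℤ) ⊗ (q⁻¹ ⊗ Κ 1ℤ)) refl (inv q)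
  qpow-2n-2 (suc n) = begin
    qpow (+ (2 *ℕ suc n) ℤ.- + 2)  ≡⟨ ≡.cong (λ k → qpow (+ k ℤ.- + 2)) (ℕ.*-suc 2 n) ⟩
    qn (2 *ℕ n)                    ≈⟨ qⁿ-2n n ⟩
    qn n * qn n                    ∎

  qpow-2n-1 : ∀ n → qpow (+ (2 *ℕ n) ℤ.- + 1) ≈ q * qⁿ⁻¹ n * qⁿ⁻¹ n
  qpow-2n-1 zero    = sym (trans (*-congʳ (q*qⁿ⁻¹ 0)) (*-identityˡ _))
  qpow-2n-1 (suc n) = begin
    qpow (+ (2 *ℕ suc n) ℤ.- + 1)  ≡⟨ ≡.cong (λ k → qpow (+ k ℤ.- + 1)) (ℕ.*-suc 2 n) ⟩
    q * qn (2 *ℕ n)                ≈⟨ *-congˡ (qⁿ-2n n) ⟩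
    q * (qn n * qn n)              ≈⟨ *-assoc q _ _ ⟨
    q * qn n * qn n                ∎

  []q-geometric : ∀ n → (1# − q) * [ n ]q ≈ 1# − qn n
  []q-geometric zero    = solve 1 (λ q → (Κ 1ℤ ⊕ ⊝ q) ⊗ Κ 0ℤ ⊜ Κ 1ℤ ⊕ ⊝ Κ 1ℤ) refl q
  []q-geometric (suc n) = begin
    (1# − q) * ([ n ]q + qn n)           ≈⟨ distribˡ _ _ _ ⟩
    (1# − q) * [ n ]q + (1# − q) * qn n  ≈⟨ +-congʳ ([]q-geometric n) ⟩
    (1# − qn n) + (1# − q) * qn n        ≈⟨ solve 2 (λ q t → (Κ 1ℤ ⊕ ⊝ t) ⊕ (Κ 1ℤ ⊕ ⊝ q) ⊗ t ⊜ Κ 1ℤ ⊕ ⊝ (q ⊗ t))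
                                                  refl q (qn n) ⟩
    1# − q * qn n                        ∎

  []q-+ : ∀ m n → [ m +ℕ n ]q ≈ [ n ]q + qn n * [ m ]q
  []q-+ zero    n = solve 2 (λ x t → x ⊜ x ⊕ t ⊗ Κ 0ℤ) refl [ n ]q (qn n)
  []q-+ (suc m) n = begin
    [ m +ℕ n ]q + pow q (m +ℕ n)          ≈⟨ +-cong ([]q-+ m n) (pow-+ q m n) ⟩
    [ n ]q + qn n * [ m ]q + qn m * qn n  ≈⟨ solve 4 (λ x t y u → x ⊕ t ⊗ y ⊕ u ⊗ t ⊜ x ⊕ t ⊗ (y ⊕ u))
                                                   refl [ n ]q (qn n) [ m ]q (qn m) ⟩
    [ n ]q + qn n * ([ m ]q + qn m)       ∎

  -- The prefactor of the closed form

  prodTo-≉0 : ∀ n f → (∀ i → f i ≉0) → prodTo n f ≉0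
  prodTo-≉0 zero    f f≉0 = nontrivial
  prodTo-≉0 (suc n) f f≉0 = *-≉0 (prodTo-≉0 n f f≉0) (f≉0 n)

  prodTo-cong : ∀ n {f g} → (∀ i → f i ≈ g i) → prodTo n f ≈ prodTo n g
  prodTo-cong zero    f≈g = refl
  prodTo-cong (suc n) f≈g = *-cong (prodTo-cong n f≈g) (f≈g n)

  prodTo-split : ∀ n f → prodTo (suc (suc n)) f ≈ f 0 * f 1 * prodTo n (λ i → f (suc (suc i)))
  prodTo-split zero    f = trans (*-congʳ (*-identityˡ _)) (sym (*-identityʳ _))
  prodTo-split (suc n) f = trans (*-congʳ (prodTo-split n f)) (*-assoc _ _ _)

  [_]q!-≉0 : ∀ n → [ n ]q! ≉0
  [ n ]q!-≉0 = prodTo-≉0 n _ [k]q≠0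

  e : ℕ → Carrier
  e k = 1# − abcd * qn k

  e-≉0 : ∀ k → e k ≉0
  e-≉0 k = ≉0-cong (+-congˡ (-‿cong (*-comm _ _))) (abcd≠ (+ k))

  𝔇 : ℕ → ℕ → Carrier
  𝔇 m r = prodTo m (λ i → e (2 *ℕ r +ℕ i))

  𝔇-≉0 : ∀ m r → 𝔇 m r ≉0
  𝔇-≉0 m r = prodTo-≉0 m _ (λ i → e-≉0 (2 *ℕ r +ℕ i))

  𝔇-split : ∀ m r → 𝔇 (suc (suc m)) r ≈ e (2 *ℕ r +ℕ 0) * e (2 *ℕ r +ℕ 1) * 𝔇 m (suc r)
  𝔇-split m r = trans (prodTo-split m _) (*-congˡ (prodTo-cong m (λ i → reflexive (≡.cong e (index i)))))
    where
    index : ∀ i → 2 *ℕ r +ℕ suc (suc i) ≡ 2 *ℕ suc r +ℕ i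
    index i = ≡.trans (ℕ.+-suc _ (suc i)) (≡.trans (≡.cong suc (ℕ.+-suc _ i))
                                                   (≡.cong (_+ℕ i) (≡.sym (ℕ.*-suc 2 r))))

  closedForm : ℕ → ℕ → Carrier
  closedForm m r = qbinom (m +ℕ r) r * (F m (b * d * qn r) / 𝔇 m r)

  prefactor : ℕ → ℕ → Carrier
  prefactor m r = [ m +ℕ r ]q! * inv ([ r ]q! * [ m ]q! * 𝔇 m r)

  prefactor-denominator-≉0 : ∀ m r → ([ r ]q! * [ m ]q! * 𝔇 m r) ≉0
  prefactor-denominator-≉0 m r = *-≉0 (*-≉0 [ r ]q!-≉0 [ m ]q!-≉0) (𝔇-≉0 m r)

  closedForm≈prefactor*F : ∀ m r → closedForm m r ≈ prefactor m r * F m (b * d * qn r)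
  closedForm≈prefactor*F m r = begin
    [ m +ℕ r ]q! * inv ([ r ]q! * [ m +ℕ r ∸ r ]q!) * (F m y * inv (𝔇 m r))
      ≡⟨ ≡.cong (λ k → [ m +ℕ r ]q! * inv ([ r ]q! * [ k ]q!) * (F m y * inv (𝔇 m r))) (ℕ.m+n∸n≡m m r) ⟩
    [ m +ℕ r ]q! * inv ([ r ]q! * [ m ]q!) * (F m y * inv (𝔇 m r))
      ≈⟨ solve 4 (λ x u⁻¹ f D⁻¹ → x ⊗ u⁻¹ ⊗ (f ⊗ D⁻¹) ⊜ x ⊗ (u⁻¹ ⊗ D⁻¹) ⊗ f) refl
           [ m +ℕ r ]q! (inv ([ r ]q! * [ m ]q!)) (F m y) (inv (𝔇 m r)) ⟩
    [ m +ℕ r ]q! * (inv ([ r ]q! * [ m ]q!) * inv (𝔇 m r)) * F m y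
      ≈⟨ *-congʳ (*-congˡ (inv-* (*-≉0 [ r ]q!-≉0 [ m ]q!-≉0) (𝔇-≉0 m r))) ⟨
    prefactor m r * F m y
      ∎
    where y = b * d * qn r

  prefactor-sucˡ : ∀ m r →
    prefactor (suc m) r ≈ prefactor m r * ([ suc (m +ℕ r) ]q * inv ([ suc m ]q * e (2 *ℕ r +ℕ m)))
  prefactor-sucˡ m r = /-ratio (prefactor-denominator-≉0 (suc m) r) (prefactor-denominator-≉0 m r)
    (*-≉0 ([k]q≠0 m) (e-≉0 (2 *ℕ r +ℕ m)))
    (solve 7 (λ x p R M D k e′ → x ⊗ p ⊗ (R ⊗ M ⊗ D ⊗ (k ⊗ e′)) ⊜ x ⊗ p ⊗ (R ⊗ (M ⊗ k) ⊗ (D ⊗ e′))) refl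
      [ m +ℕ r ]q! [ suc (m +ℕ r) ]q [ r ]q! [ m ]q! (𝔇 m r) [ suc m ]q (e (2 *ℕ r +ℕ m)))

  prefactor-sucˡ-predʳ : ∀ m j →
    prefactor (suc m) j ≈ prefactor m (suc j) * ([ suc j ]q * e (2 *ℕ j +ℕ suc m)
                                                 * inv ([ suc m ]q * (e (2 *ℕ j +ℕ 0) * e (2 *ℕ j +ℕ 1))))
  prefactor-sucˡ-predʳ m j =
    /-ratio (prefactor-denominator-≉0 (suc m) j) (prefactor-denominator-≉0 m (suc j))
            (*-≉0 ([k]q≠0 m) (*-≉0 (e-≉0 (2 *ℕ j +ℕ 0)) (e-≉0 (2 *ℕ j +ℕ 1)))) (begin
      [ suc m +ℕ j ]q! * ([ suc j ]q! * [ m ]q! * 𝔇 m (suc j) * ([ suc m ]q * (e₀ * e₁)))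
        ≈⟨ solve 8 (λ x J j₁ M D k e₀ e₁ →
             x ⊗ (J ⊗ j₁ ⊗ M ⊗ D ⊗ (k ⊗ (e₀ ⊗ e₁))) ⊜ x ⊗ (j₁ ⊗ (J ⊗ (M ⊗ k)) ⊗ (e₀ ⊗ e₁ ⊗ D))) refl
             [ suc m +ℕ j ]q! [ j ]q! [ suc j ]q [ m ]q! (𝔇 m (suc j)) [ suc m ]q e₀ e₁ ⟩
      [ suc m +ℕ j ]q! * ([ suc j ]q * ([ j ]q! * [ suc m ]q!) * (e₀ * e₁ * 𝔇 m (suc j)))
        ≈⟨ *-cong (reflexive (≡.cong [_]q! (ℕ.+-suc m j))) (*-congˡ (𝔇-split m j)) ⟨
      [ m +ℕ suc j ]q! * ([ suc j ]q * ([ j ]q! * [ suc m ]q!) * 𝔇 (2 +ℕ m) j)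
        ≈⟨ solve 6 (λ x j₁ J M D e′ → x ⊗ (j₁ ⊗ (J ⊗ M) ⊗ (D ⊗ e′)) ⊜ x ⊗ (j₁ ⊗ e′) ⊗ (J ⊗ M ⊗ D)) refl
             [ m +ℕ suc j ]q! [ suc j ]q [ j ]q! [ suc m ]q! (𝔇 (suc m) j) (e (2 *ℕ j +ℕ suc m)) ⟩
      [ m +ℕ suc j ]q! * ([ suc j ]q * e (2 *ℕ j +ℕ suc m)) * ([ j ]q! * [ suc m ]q! * 𝔇 (suc m) j) ∎)
    where
    e₀ e₁ : Carrier
    e₀ = e (2 *ℕ j +ℕ 0)
    e₁ = e (2 *ℕ j +ℕ 1)

  prefactor-predˡ-sucʳ : ∀ k r →
    prefactor k (suc r) ≈ prefactor (suc k) r * ([ suc k ]q * (e (2 *ℕ r +ℕ 0) * e (2 *ℕ r +ℕ 1))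
                                                 * inv ([ suc r ]q * e (2 *ℕ r +ℕ suc k)))
  prefactor-predˡ-sucʳ k r =
    /-ratio (prefactor-denominator-≉0 k (suc r)) (prefactor-denominator-≉0 (suc k) r)
            (*-≉0 ([k]q≠0 r) (e-≉0 (2 *ℕ r +ℕ suc k))) (begin
      [ k +ℕ suc r ]q! * ([ r ]q! * [ suc k ]q! * 𝔇 (suc k) r * ([ suc r ]q * e (2 *ℕ r +ℕ suc k)))
        ≈⟨ solve 7 (λ x R K k₁ D r₁ e′ →
             x ⊗ (R ⊗ (K ⊗ k₁) ⊗ D ⊗ (r₁ ⊗ e′)) ⊜ x ⊗ (R ⊗ r₁ ⊗ K ⊗ k₁ ⊗ (D ⊗ e′))) refl
             [ k +ℕ suc r ]q! [ r ]q! [ k ]q! [ suc k ]q (𝔇 (suc k) r) [ suc r ]q (e (2 *ℕ r +ℕ suc k)) ⟩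
      [ k +ℕ suc r ]q! * ([ suc r ]q! * [ k ]q! * [ suc k ]q * 𝔇 (2 +ℕ k) r)
        ≈⟨ *-cong (reflexive (≡.cong [_]q! (ℕ.+-suc k r))) (*-congˡ (𝔇-split k r)) ⟩
      [ suc k +ℕ r ]q! * ([ suc r ]q! * [ k ]q! * [ suc k ]q * (e₀ * e₁ * 𝔇 k (suc r)))
        ≈⟨ solve 7 (λ x R K k₁ e₀ e₁ D →
             x ⊗ (R ⊗ K ⊗ k₁ ⊗ (e₀ ⊗ e₁ ⊗ D)) ⊜ x ⊗ (k₁ ⊗ (e₀ ⊗ e₁)) ⊗ (R ⊗ K ⊗ D)) refl
             [ suc k +ℕ r ]q! [ suc r ]q! [ k ]q! [ suc k ]q e₀ e₁ (𝔇 k (suc r)) ⟩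
      [ suc k +ℕ r ]q! * ([ suc k ]q * (e₀ * e₁)) * ([ suc r ]q! * [ k ]q! * 𝔇 k (suc r)) ∎)
    where
    e₀ e₁ : Carrier
    e₀ = e (2 *ℕ r +ℕ 0)
    e₁ = e (2 *ℕ r +ℕ 1)

  -- The local identity

  e≈ε : ∀ k {x} → qn k ≈ x → e k ≈ ε x
  e≈ε k qᵏ≈x = +-congˡ (-‿cong (trans (*-comm abcd _) (*-congʳ qᵏ≈x)))

  ε-≉0 : ∀ k {x} → qpow k ≈ x → ε x ≉0
  ε-≉0 k qᵏ≈x = ≉0-cong (ε-cong qᵏ≈x) (abcd≠ k)

  -- Everything about column r is expressed through v = q^(r-1) (which is q⁻¹ when r = 0)
  -- and s = q v = qʳ, so that the local identity becomes a polynomial identity in q and v.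
  module Column (r : ℕ) where
    v s y₀ : Carrier
    v  = qⁿ⁻¹ r
    s  = q * v
    y₀ = q * (b * d * v)

    qʳ≈s : qn r ≈ s
    qʳ≈s = sym (q*qⁿ⁻¹ r)

    q²ʳ≈s² : qn (2 *ℕ r) ≈ s * s
    q²ʳ≈s² = trans (qⁿ-2n r) (*-cong qʳ≈s qʳ≈s)

    q²ʳ⁺ⁱ≈s²qⁱ : ∀ i → qn (2 *ℕ r +ℕ i) ≈ s * s * qn i
    q²ʳ⁺ⁱ≈s²qⁱ i = trans (pow-+ q (2 *ℕ r) i) (*-congʳ q²ʳ≈s²)

    q²ʳ⁺¹≈qs² : qn (2 *ℕ r +ℕ 1) ≈ q * (s * s)
    q²ʳ⁺¹≈qs² = trans (q²ʳ⁺ⁱ≈s²qⁱ 1) (solve 2 (λ s q → s ⊗ s ⊗ (q ⊗ Κ 1ℤ) ⊜ q ⊗ (s ⊗ s)) refl s q)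

    y₀≈bds : y₀ ≈ b * d * s
    y₀≈bds = solve 4 (λ q b d v → q ⊗ (b ⊗ d ⊗ v) ⊜ b ⊗ d ⊗ (q ⊗ v)) refl q b d v

    d♮≈ : d♮ r ≈ v * inv (ε (v * v) * ε (s * s)) * bracket♮ v s (q * v * v) (s * s)
    d♮≈ = *-cong (*-congˡ (inv-cong (*-cong (ε-cong (qpow-2n-2 r)) (ε-cong q²ʳ≈s²))))
                 (bracket♮-cong qʳ≈s (qpow-2n-1 r) q²ʳ≈s²)

    d♭≈ : d♭ r ≈ - (s * (b * d) * inv (ac-bd s))
                   * (𝒜num v ((1# − q) * [ suc r ]q) s * inv (𝒜den (q * v * v) (s * s) (q * (s * s))))
    d♭≈ = *-cong (-‿cong (*-cong (*-congʳ qʳ≈s) (inv-cong (ac-bd-cong qʳ≈s))))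
                 (*-cong (𝒜num-cong (sym ([]q-geometric (suc r))) qʳ≈s)
                         (inv-cong (𝒜den-cong (qpow-2n-1 r) q²ʳ≈s² q²ʳ⁺¹≈qs²)))

    εv²≉0 : ε (v * v) ≉0
    εv²≉0 = ε-≉0 (+ (2 *ℕ r) ℤ.- + 2) (qpow-2n-2 r)

    εqv²≉0 : ε (q * v * v) ≉0
    εqv²≉0 = ε-≉0 (+ (2 *ℕ r) ℤ.- + 1) (qpow-2n-1 r)

    εs²≉0 : ε (s * s) ≉0
    εs²≉0 = ε-≉0 (+ (2 *ℕ r)) q²ʳ≈s²

    εqs²≉0 : ε (q * (s * s)) ≉0
    εqs²≉0 = ε-≉0 (+ (2 *ℕ r +ℕ 1)) q²ʳ⁺¹≈qs²

    εs²qⁱ≉0 : ∀ i → ε (s * s * qn i) ≉0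
    εs²qⁱ≉0 i = ε-≉0 (+ (2 *ℕ r +ℕ i)) (q²ʳ⁺ⁱ≈s²qⁱ i)

    ac-bd≉0 : ac-bd s ≉0
    ac-bd≉0 = *-≉0 (≉0-cong (+-congˡ (-‿cong (*-congʳ qʳ≈s))) (ac≠ r))
                   (≉0-cong (+-congˡ (-‿cong (*-congʳ qʳ≈s))) (bd≠ r))

    𝒜den≉0 : 𝒜den (q * v * v) (s * s) (q * (s * s)) ≉0
    𝒜den≉0 = *-≉0 (*-≉0 εqv²≉0 (*-≉0 εs²≉0 (*-≉0 εs²≉0 nontrivial))) εqs²≉0

    -- Multiplied by [ m ]q so that it also holds, trivially, for m = 0.
    contiguous : ∀ m → [ m ]q * (quartic s * F₋ m (q * y₀))
                       ≈ [ m ]q * (ε (s * s) * ε (q * v * v * qn m) * F₋ m y₀ − contigᵇ s * F m y₀)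
    contiguous zero    = trans (zeroˡ _) (sym (zeroˡ _))
    contiguous (suc k) = *-congˡ (trans (F-contiguous-at k s y₀≈bds) (+-congʳ (*-congʳ
      (solve 7 (λ a b c d q v w →
         (Κ 1ℤ ⊕ ⊝ (a ⊗ b ⊗ c ⊗ d ⊗ (q ⊗ v ⊗ (q ⊗ v)))) ⊗ (Κ 1ℤ ⊕ ⊝ (a ⊗ b ⊗ c ⊗ d ⊗ (w ⊗ (q ⊗ v ⊗ (q ⊗ v)))))
         ⊜ (Κ 1ℤ ⊕ ⊝ (q ⊗ v ⊗ (q ⊗ v) ⊗ (a ⊗ b ⊗ c ⊗ d))) ⊗ (Κ 1ℤ ⊕ ⊝ (q ⊗ v ⊗ v ⊗ (q ⊗ w) ⊗ (a ⊗ b ⊗ c ⊗ d))))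
         refl a b c d q v (qn k)))))

  -- Dividing the recurrence at (m + 1, r) by prefactor m r leaves ρ = ρ♯ + ρ♮ + ρ♭.  Multiplied by
  -- the common denominator D, each of the four terms becomes X times a polynomial kᵢ.
  module LocalIdentity (m r : ℕ) where
    open Column r

    t : Carrier
    t = qn m

    ρ ρ♯ ρ♮ ρ♭ : Carrier
    ρ  = [ suc (m +ℕ r) ]q * inv ([ suc m ]q * ε (s * s * t)) * F (suc m) y₀
    ρ♯ = [ r ]q * ε (q * v * v * t) * inv ([ suc m ]q * (ε (v * v) * ε (q * v * v))) * F (suc m) (b * d * v)
    ρ♮ = F m y₀ * (v * inv (ε (v * v) * ε (s * s)) * bracket♮ v s (q * v * v) (s * s))
    ρ♭ = [ m ]q * (ε (s * s) * ε (q * (s * s))) * inv ([ suc r ]q * ε (s * s * t)) * F₋ m (q * y₀)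
         * (- (s * (b * d) * inv (ac-bd s))
            * (𝒜num v ((1# − q) * [ suc r ]q) s * inv (𝒜den (q * v * v) (s * s) (q * (s * s)))))

    X D : Carrier
    X = [ suc r ]q * ac-bd s * ε (s * s) * ε (q * (s * s))
    D = X * ([ suc m ]q * ε (s * s * t) * ε (v * v) * ε (q * v * v) * ε (s * s))

    k₀ k₁ k₂ k₃ : Carrier
    k₀ = [ suc (m +ℕ r) ]q * (F (suc m) y₀ * (ε (v * v) * ε (q * v * v) * ε (s * s)))
    k₁ = [ r ]q * (ε (q * v * v * t) * F (suc m) (b * d * v) * (ε (s * s * t) * ε (s * s)))
    k₂ = [ suc m ]q * X₂ v t (F m y₀)
    k₃ = - ([ suc m ]q * [ m ]q * (1# − q) * (s * (b * d)) * ε v * quartic s * F₋ m (q * y₀) * ε (v * v))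

    core : k₀ ≈ k₁ + k₂ + k₃
    core = begin
      k₀                              ≈⟨ *-congˡ (*-congʳ (F-suc-at-q m (b * d * v))) ⟩
      [ suc (m +ℕ r) ]q * X₀ v t P Q  ≈⟨ divided-difference-elimination [m+r+1]q-split (quotient-spec v t P Q)
                                                                        [r]q-relation (quotient-residue v t P Q) ⟩
      [ r ]q * X₁ v t P Q + [ suc m ]q * (X₂ v t P + (1# − t) * X₃ v t P Q)
        ≈⟨ solve 5 (λ x y z u w → x ⊕ y ⊗ (z ⊕ u ⊗ w) ⊜ x ⊕ y ⊗ z ⊕ y ⊗ (u ⊗ w)) refl
             ([ r ]q * X₁ v t P Q) [ suc m ]q (X₂ v t P) (1# − t) (X₃ v t P Q) ⟩
      [ r ]q * X₁ v t P Q + k₂ + [ suc m ]q * ((1# − t) * X₃ v t P Q)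
        ≈⟨ +-cong (+-congʳ (*-congˡ (*-congʳ (*-congˡ (sym (F-shift m (b * d * v))))))) (sym k₃≈) ⟩
      k₁ + k₂ + k₃ ∎
      where
      P Q : Carrier
      P = F m y₀
      Q = F₋ m y₀

      [m+r+1]q-split : [ suc (m +ℕ r) ]q ≈ [ suc m ]q + q * t * [ r ]q
      [m+r+1]q-split = trans (reflexive (≡.cong [_]q (≡.trans (≡.cong suc (ℕ.+-comm m r)) (≡.sym (ℕ.+-suc r m)))))
                             ([]q-+ r (suc m))

      [r]q-relation : [ r ]q * (1# − q * t) ≈ [ suc m ]q * (1# − q * v)
      [r]q-relation = begin
        [ r ]q * (1# − q * t)             ≈⟨ *-congˡ ([]q-geometric (suc m)) ⟨
        [ r ]q * ((1# − q) * [ suc m ]q)  ≈⟨ solve 3 (λ x q y → x ⊗ ((Κ 1ℤ ⊕ ⊝ q) ⊗ y) ⊜ y ⊗ ((Κ 1ℤ ⊕ ⊝ q) ⊗ x))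
                                                   refl [ r ]q q [ suc m ]q ⟩
        [ suc m ]q * ((1# − q) * [ r ]q)  ≈⟨ *-congˡ ([]q-geometric r) ⟩
        [ suc m ]q * (1# − qn r)          ≈⟨ *-congˡ (+-congˡ (-‿cong qʳ≈s)) ⟩
        [ suc m ]q * (1# − q * v)         ∎

      k₃≈ : k₃ ≈ [ suc m ]q * ((1# − t) * X₃ v t P Q)
      k₃≈ = begin
        k₃
          ≈⟨ solve 8 (λ M₁ M o c εv π U εvv →
               ⊝ (M₁ ⊗ M ⊗ o ⊗ c ⊗ εv ⊗ π ⊗ U ⊗ εvv) ⊜ ⊝ (M₁ ⊗ c ⊗ εv ⊗ εvv ⊗ o) ⊗ (M ⊗ (π ⊗ U))) refl
               [ suc m ]q [ m ]q (1# − q) (s * (b * d)) (ε v) (quartic s) (F₋ m (q * y₀)) (ε (v * v)) ⟩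
        - c′ * ([ m ]q * (quartic s * F₋ m (q * y₀)))
          ≈⟨ *-congˡ (contiguous m) ⟩
        - c′ * ([ m ]q * (ε (s * s) * ε (q * v * v * t) * Q − contigᵇ s * P))
          ≈⟨ solve 8 (λ M₁ c εv εvv o M G H →
               ⊝ (M₁ ⊗ c ⊗ εv ⊗ εvv ⊗ o) ⊗ (M ⊗ (G ⊕ ⊝ H)) ⊜ M₁ ⊗ (o ⊗ M ⊗ (c ⊗ εv ⊗ εvv ⊗ (H ⊕ ⊝ G)))) refl
               [ suc m ]q (s * (b * d)) (ε v) (ε (v * v)) (1# − q) [ m ]q
               (ε (s * s) * ε (q * v * v * t) * Q) (contigᵇ s * P) ⟩
        [ suc m ]q * ((1# − q) * [ m ]q * X₃ v t P Q)
          ≈⟨ *-congˡ (*-congʳ ([]q-geometric m)) ⟩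
        [ suc m ]q * ((1# − t) * X₃ v t P Q)
          ∎
        where
        c′ : Carrier
        c′ = [ suc m ]q * (s * (b * d)) * ε v * ε (v * v) * (1# − q)

    X≉0 : X ≉0
    X≉0 = *-≉0 (*-≉0 (*-≉0 ([k]q≠0 r) ac-bd≉0) εs²≉0) εqs²≉0

    D≉0 : D ≉0
    D≉0 = *-≉0 X≉0 (*-≉0 (*-≉0 (*-≉0 (*-≉0 ([k]q≠0 m) (εs²qⁱ≉0 m)) εv²≉0) εqv²≉0) εs²≉0)

    cleared : ρ * D ≈ X * k₀
    cleared = trans
      (solve 9 (λ N i F X M E Evv Eqvv Ess →
         N ⊗ i ⊗ F ⊗ (X ⊗ (M ⊗ E ⊗ Evv ⊗ Eqvv ⊗ Ess)) ⊜ X ⊗ (N ⊗ (F ⊗ (Evv ⊗ Eqvv ⊗ Ess))) ⊗ (M ⊗ E ⊗ i)) refl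
         [ suc (m +ℕ r) ]q (inv ([ suc m ]q * ε (s * s * t))) (F (suc m) y₀) X
         [ suc m ]q (ε (s * s * t)) (ε (v * v)) (ε (q * v * v)) (ε (s * s)))
      (*-inverseʳ-cancel (*-≉0 ([k]q≠0 m) (εs²qⁱ≉0 m)) _)

    cleared♯ : ρ♯ * D ≈ X * k₁
    cleared♯ = trans
      (solve 10 (λ R E′ i F X M E Evv Eqvv Ess →
         R ⊗ E′ ⊗ i ⊗ F ⊗ (X ⊗ (M ⊗ E ⊗ Evv ⊗ Eqvv ⊗ Ess))
         ⊜ X ⊗ (R ⊗ (E′ ⊗ F ⊗ (E ⊗ Ess))) ⊗ (M ⊗ (Evv ⊗ Eqvv) ⊗ i)) refl
         [ r ]q (ε (q * v * v * t)) (inv ([ suc m ]q * (ε (v * v) * ε (q * v * v)))) (F (suc m) (b * d * v)) X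
         [ suc m ]q (ε (s * s * t)) (ε (v * v)) (ε (q * v * v)) (ε (s * s)))
      (*-inverseʳ-cancel (*-≉0 ([k]q≠0 m) (*-≉0 εv²≉0 εqv²≉0)) _)

    cleared♮ : ρ♮ * D ≈ X * k₂
    cleared♮ = trans
      (solve 10 (λ P v i B X M E Evv Eqvv Ess →
         P ⊗ (v ⊗ i ⊗ B) ⊗ (X ⊗ (M ⊗ E ⊗ Evv ⊗ Eqvv ⊗ Ess))
         ⊜ X ⊗ (M ⊗ (P ⊗ v ⊗ B ⊗ (E ⊗ Eqvv))) ⊗ (Evv ⊗ Ess ⊗ i)) refl
         (F m y₀) v (inv (ε (v * v) * ε (s * s))) (bracket♮ v s (q * v * v) (s * s)) X
         [ suc m ]q (ε (s * s * t)) (ε (v * v)) (ε (q * v * v)) (ε (s * s)))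
      (*-inverseʳ-cancel (*-≉0 εv²≉0 εs²≉0) _)

    cleared♭ : ρ♭ * D ≈ X * k₃
    cleared♭ = begin
      ρ♭ * D
        ≈⟨ solve 21 (λ Nm Ess Eqss i₁ U c i₂ εv o R₁ fab fac fad fbc fbd fcd i₃ M E Evv Eqvv →
             Nm ⊗ (Ess ⊗ Eqss) ⊗ i₁ ⊗ U
               ⊗ (⊝ (c ⊗ i₂) ⊗ (εv ⊗ (o ⊗ R₁) ⊗ fab ⊗ fac ⊗ fad ⊗ fbc ⊗ fbd ⊗ fcd ⊗ i₃))
               ⊗ (R₁ ⊗ (fac ⊗ fbd) ⊗ Ess ⊗ Eqss ⊗ (M ⊗ E ⊗ Evv ⊗ Eqvv ⊗ Ess))
             ⊜ R₁ ⊗ (fac ⊗ fbd) ⊗ Ess ⊗ Eqss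
               ⊗ ⊝ (M ⊗ Nm ⊗ o ⊗ c ⊗ εv ⊗ (fab ⊗ fad ⊗ fbc ⊗ fcd) ⊗ U ⊗ Evv)
               ⊗ (R₁ ⊗ E ⊗ i₁) ⊗ (fac ⊗ fbd ⊗ i₂) ⊗ (Eqvv ⊗ (Ess ⊗ (Ess ⊗ Κ 1ℤ)) ⊗ Eqss ⊗ i₃)) refl
             [ m ]q (ε (s * s)) (ε (q * (s * s))) (inv ([ suc r ]q * ε (s * s * t))) (F₋ m (q * y₀))
             (s * (b * d)) (inv (ac-bd s)) (ε v) (1# − q) [ suc r ]q
             (1# − s * (a * b)) (1# − s * (a * c)) (1# − s * (a * d))
             (1# − s * (b * c)) (1# − s * (b * d)) (1# − s * (c * d))
             (inv 𝒜ₛ) [ suc m ]q (ε (s * s * t)) (ε (v * v)) (ε (q * v * v)) ⟩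
      X * k₃ * (R₁E * inv R₁E) * (ac-bd s * inv (ac-bd s)) * (𝒜ₛ * inv 𝒜ₛ)
        ≈⟨ *-inverseʳ-cancel 𝒜den≉0 _ ⟩
      X * k₃ * (R₁E * inv R₁E) * (ac-bd s * inv (ac-bd s))
        ≈⟨ *-inverseʳ-cancel ac-bd≉0 _ ⟩
      X * k₃ * (R₁E * inv R₁E)
        ≈⟨ *-inverseʳ-cancel (*-≉0 ([k]q≠0 r) (εs²qⁱ≉0 m)) _ ⟩
      X * k₃
        ∎
      where
      R₁E 𝒜ₛ : Carrier
      R₁E = [ suc r ]q * ε (s * s * t)
      𝒜ₛ  = 𝒜den (q * v * v) (s * s) (q * (s * s))

    local-step : ρ ≈ ρ♯ + ρ♮ + ρ♭
    local-step = *-cancelʳ D≉0 (begin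
      ρ * D                     ≈⟨ cleared ⟩
      X * k₀                    ≈⟨ *-congˡ core ⟩
      X * (k₁ + k₂ + k₃)        ≈⟨ solve 4 (λ X x y z → X ⊗ (x ⊕ y ⊕ z) ⊜ X ⊗ x ⊕ X ⊗ y ⊕ X ⊗ z) refl X k₁ k₂ k₃ ⟩
      X * k₁ + X * k₂ + X * k₃  ≈⟨ +-cong (+-cong cleared♯ cleared♮) cleared♭ ⟨
      ρ♯ * D + ρ♮ * D + ρ♭ * D  ≈⟨ solve 4 (λ D x y z → x ⊗ D ⊕ y ⊗ D ⊕ z ⊗ D ⊜ (x ⊕ y ⊕ z) ⊗ D) refl D ρ♯ ρ♮ ρ♭ ⟩
      (ρ♯ + ρ♮ + ρ♭) * D        ∎)

  -- The recurrence satisfied by the closed form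

  previousColumn nextColumn : ℕ → ℕ → Carrier
  previousColumn m zero    = 0#
  previousColumn m (suc j) = closedForm (suc m) j
  nextColumn zero    r = 0#
  nextColumn (suc k) r = closedForm k (suc r)

  closedForm-sucˡ : ∀ m r → closedForm (suc m) r ≈ prefactor m r * LocalIdentity.ρ m r
  closedForm-sucˡ m r = begin
    closedForm (suc m) r                            ≈⟨ closedForm≈prefactor*F (suc m) r ⟩
    prefactor (suc m) r * F (suc m) (b * d * qn r)  ≈⟨ *-congʳ (prefactor-sucˡ m r) ⟩
    prefactor m r * ratio * F (suc m) (b * d * qn r) ≈⟨ *-assoc _ _ _ ⟩
    prefactor m r * (ratio * F (suc m) (b * d * qn r))
      ≈⟨ *-congˡ (*-cong (*-congˡ (inv-cong (*-congˡ (e≈ε (2 *ℕ r +ℕ m) (q²ʳ⁺ⁱ≈s²qⁱ m)))))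
                         (F-cong (suc m) (trans (*-congˡ qʳ≈s) (sym y₀≈bds)))) ⟩
    prefactor m r * LocalIdentity.ρ m r             ∎
    where
    open Column r
    ratio : Carrier
    ratio = [ suc (m +ℕ r) ]q * inv ([ suc m ]q * e (2 *ℕ r +ℕ m))

  previousColumn≈ : ∀ m r → previousColumn m r ≈ prefactor m r * LocalIdentity.ρ♯ m r
  previousColumn≈ m zero    = solve 4 (λ C x y z → Κ 0ℤ ⊜ C ⊗ (Κ 0ℤ ⊗ x ⊗ y ⊗ z)) refl (prefactor m 0) _ _ _
  previousColumn≈ m (suc j) = begin
    closedForm (suc m) j                                  ≈⟨ closedForm≈prefactor*F (suc m) j ⟩
    prefactor (suc m) j * F (suc m) (b * d * qn j)        ≈⟨ *-congʳ (prefactor-sucˡ-predʳ m j) ⟩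
    prefactor m (suc j) * ratio * F (suc m) (b * d * qn j) ≈⟨ *-assoc _ _ _ ⟩
    prefactor m (suc j) * (ratio * F (suc m) (b * d * qn j))
      ≈⟨ *-congˡ (*-congʳ (*-cong (*-congˡ (e≈ε (2 *ℕ j +ℕ suc m) q²ʲ⁺ᵐ⁺¹≈))
                                  (inv-cong (*-congˡ (*-cong (e≈ε (2 *ℕ j +ℕ 0) q²ʲ≈)
                                                             (e≈ε (2 *ℕ j +ℕ 1) q²ʲ⁺¹≈)))))) ⟩
    prefactor m (suc j) * LocalIdentity.ρ♯ m (suc j)      ∎
    where
    ratio : Carrier
    ratio = [ suc j ]q * e (2 *ℕ j +ℕ suc m) * inv ([ suc m ]q * (e (2 *ℕ j +ℕ 0) * e (2 *ℕ j +ℕ 1)))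
    q²ʲ≈ : qn (2 *ℕ j +ℕ 0) ≈ qn j * qn j
    q²ʲ≈ = trans (qⁿ-2n+i j 0) (*-identityʳ _)
    q²ʲ⁺¹≈ : qn (2 *ℕ j +ℕ 1) ≈ q * qn j * qn j
    q²ʲ⁺¹≈ = trans (qⁿ-2n+i j 1) (solve 2 (λ v q → v ⊗ v ⊗ (q ⊗ Κ 1ℤ) ⊜ q ⊗ v ⊗ v) refl (qn j) q)
    q²ʲ⁺ᵐ⁺¹≈ : qn (2 *ℕ j +ℕ suc m) ≈ q * qn j * qn j * qn m
    q²ʲ⁺ᵐ⁺¹≈ = trans (qⁿ-2n+i j (suc m)) (solve 3 (λ v q t → v ⊗ v ⊗ (q ⊗ t) ⊜ q ⊗ v ⊗ v ⊗ t) refl (qn j) q (qn m))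

  sameColumn≈ : ∀ m r → closedForm m r * d♮ r ≈ prefactor m r * LocalIdentity.ρ♮ m r
  sameColumn≈ m r = begin
    closedForm m r * d♮ r                         ≈⟨ *-congʳ (closedForm≈prefactor*F m r) ⟩
    prefactor m r * F m (b * d * qn r) * d♮ r     ≈⟨ *-assoc _ _ _ ⟩
    prefactor m r * (F m (b * d * qn r) * d♮ r)
      ≈⟨ *-congˡ (*-cong (F-cong m (trans (*-congˡ qʳ≈s) (sym y₀≈bds))) d♮≈) ⟩
    prefactor m r * LocalIdentity.ρ♮ m r          ∎
    where open Column r

  nextColumn≈ : ∀ m r → nextColumn m r * d♭ r ≈ prefactor m r * LocalIdentity.ρ♭ m r
  nextColumn≈ zero    r =
    solve 6 (λ d C x y z w → Κ 0ℤ ⊗ d ⊜ C ⊗ (Κ 0ℤ ⊗ x ⊗ y ⊗ z ⊗ w)) refl (d♭ r) (prefactor 0 r) _ _ _ _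
  nextColumn≈ (suc k) r = begin
    closedForm k (suc r) * d♭ r                              ≈⟨ *-congʳ (closedForm≈prefactor*F k (suc r)) ⟩
    prefactor k (suc r) * F k (b * d * qn (suc r)) * d♭ r    ≈⟨ *-congʳ (*-congʳ (prefactor-predˡ-sucʳ k r)) ⟩
    prefactor (suc k) r * ratio * F k (b * d * qn (suc r)) * d♭ r
      ≈⟨ solve 4 (λ C x F y → C ⊗ x ⊗ F ⊗ y ⊜ C ⊗ (x ⊗ F ⊗ y)) refl
           (prefactor (suc k) r) ratio (F k (b * d * qn (suc r))) (d♭ r) ⟩
    prefactor (suc k) r * (ratio * F k (b * d * qn (suc r)) * d♭ r)
      ≈⟨ *-congˡ (*-cong (*-cong ratio≈ (F-cong k bdqʳ⁺¹≈)) d♭≈) ⟩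
    prefactor (suc k) r * LocalIdentity.ρ♭ (suc k) r         ∎
    where
    open Column r
    ratio : Carrier
    ratio = [ suc k ]q * (e (2 *ℕ r +ℕ 0) * e (2 *ℕ r +ℕ 1)) * inv ([ suc r ]q * e (2 *ℕ r +ℕ suc k))
    ratio≈ : ratio ≈ [ suc k ]q * (ε (s * s) * ε (q * (s * s))) * inv ([ suc r ]q * ε (s * s * qn (suc k)))
    ratio≈ = *-cong (*-congˡ (*-cong (e≈ε (2 *ℕ r +ℕ 0) (trans (q²ʳ⁺ⁱ≈s²qⁱ 0) (*-identityʳ _)))
                                     (e≈ε (2 *ℕ r +ℕ 1) q²ʳ⁺¹≈qs²)))
                    (inv-cong (*-congˡ (e≈ε (2 *ℕ r +ℕ suc k) (q²ʳ⁺ⁱ≈s²qⁱ (suc k)))))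
    bdqʳ⁺¹≈ : b * d * qn (suc r) ≈ q * y₀
    bdqʳ⁺¹≈ = trans (*-congˡ (*-congˡ qʳ≈s))
                    (solve 4 (λ b d q v → b ⊗ d ⊗ (q ⊗ (q ⊗ v)) ⊜ q ⊗ (q ⊗ (b ⊗ d ⊗ v))) refl b d q v)

  closedForm-recurrence : ∀ m r →
    closedForm (suc m) r ≈ previousColumn m r + closedForm m r * d♮ r + nextColumn m r * d♭ r
  closedForm-recurrence m r = begin
    closedForm (suc m) r                        ≈⟨ closedForm-sucˡ m r ⟩
    prefactor m r * ρ                           ≈⟨ *-congˡ local-step ⟩
    prefactor m r * (ρ♯ + ρ♮ + ρ♭)
      ≈⟨ solve 4 (λ C x y z → C ⊗ (x ⊕ y ⊕ z) ⊜ C ⊗ x ⊕ C ⊗ y ⊕ C ⊗ z) refl (prefactor m r) ρ♯ ρ♮ ρ♭ ⟩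
    prefactor m r * ρ♯ + prefactor m r * ρ♮ + prefactor m r * ρ♭
      ≈⟨ +-cong (+-cong (previousColumn≈ m r) (sameColumn≈ m r)) (nextColumn≈ m r) ⟨
    previousColumn m r + closedForm m r * d♮ r + nextColumn m r * d♭ r ∎
    where open LocalIdentity m r

  closedForm-zeroˡ : ∀ r → closedForm 0 r ≈ 1#
  closedForm-zeroˡ r = begin
    closedForm 0 r                          ≈⟨ closedForm≈prefactor*F 0 r ⟩
    [ r ]q! * inv ([ r ]q! * 1# * 1#) * 1#  ≈⟨ *-identityʳ _ ⟩
    [ r ]q! * inv ([ r ]q! * 1# * 1#)       ≈⟨ *-congˡ (inv-cong (trans (*-identityʳ _) (*-identityʳ _))) ⟩
    [ r ]q! * inv [ r ]q!                   ≈⟨ inverse _ [ r ]q!-≉0 ⟩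
    1#                                      ∎

  -- The first row of 𝖽ᴺ

  𝖽-diagonal : ∀ j → 𝖽 j j ≡ d♮ j
  𝖽-diagonal j with j ≟ j
  ... | yes _   = ≡.refl
  ... | no j≢j  = ⊥-elim (j≢j ≡.refl)

  𝖽-super : ∀ j → 𝖽 j (suc j) ≡ 1#
  𝖽-super j with j ≟ suc j
  ... | yes j≡1+j = ⊥-elim (ℕ.1+n≢n (≡.sym j≡1+j))
  ... | no _ with suc j ≟ suc j
  ...   | yes _ = ≡.refl
  ...   | no ≢  = ⊥-elim (≢ ≡.refl)

  𝖽-sub : ∀ j → 𝖽 (suc j) j ≡ d♭ j
  𝖽-sub j with suc j ≟ j
  ... | yes 1+j≡j = ⊥-elim (ℕ.1+n≢n 1+j≡j)
  ... | no _ with j ≟ suc (suc j)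
  ...   | yes j≡2+j = ⊥-elim (ℕ.<⇒≢ (ℕ.m<n⇒m<1+n (ℕ.n<1+n j)) j≡2+j)
  ...   | no _ with suc j ≟ suc j
  ...     | yes _ = ≡.refl
  ...     | no ≢  = ⊥-elim (≢ ≡.refl)

  𝖽-far : ∀ k j → 2 +ℕ k ≤ j → 𝖽 k j ≡ 0#
  𝖽-far k j 2+k≤j with k ≟ j
  ... | yes k≡j = ⊥-elim (ℕ.<⇒≢ (ℕ.<-trans (ℕ.n<1+n k) 2+k≤j) k≡j)
  ... | no _ with j ≟ suc k
  ...   | yes j≡1+k = ⊥-elim (ℕ.<⇒≢ 2+k≤j (≡.sym j≡1+k))
  ...   | no _ with k ≟ suc j
  ...     | yes k≡1+j = ⊥-elim (ℕ.<⇒≢ (ℕ.<-trans (ℕ.<-trans (ℕ.n<1+n k) 2+k≤j) (ℕ.n<1+n j)) k≡1+j)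
  ...     | no _      = ≡.refl

  sumTo-zero : ∀ n f → (∀ k → k < n → f k ≈ 0#) → sumTo n f ≈ 0#
  sumTo-zero zero    f f≈0 = refl
  sumTo-zero (suc n) f f≈0 =
    trans (+-cong (sumTo-zero n f (λ k k<n → f≈0 k (ℕ.m<n⇒m<1+n k<n))) (f≈0 n (ℕ.n<1+n n))) (+-identityʳ 0#)

  previousEntry : ℕ → ℕ → Carrier
  previousEntry N zero    = 0#
  previousEntry N (suc j) = ⟨W|𝖽^ N |V^ j ⟩

  first-row-recurrence : ∀ N r →
    ⟨W|𝖽^ suc N |V^ r ⟩ ≈ previousEntry N r + ⟨W|𝖽^ N |V^ r ⟩ * d♮ r + ⟨W|𝖽^ N |V^ suc r ⟩ * d♭ r
  first-row-recurrence N zero    =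
    +-cong (+-congˡ (*-congˡ (reflexive (𝖽-diagonal 0)))) (*-congˡ (reflexive (𝖽-sub 0)))
  first-row-recurrence N (suc j) =
    +-cong (+-cong superdiagonal (*-congˡ (reflexive (𝖽-diagonal (suc j))))) (*-congˡ (reflexive (𝖽-sub (suc j))))
    where
    superdiagonal : sumTo (suc j) (λ k → 𝖽^ N 0 k * 𝖽 k (suc j)) ≈ 𝖽^ N 0 j
    superdiagonal =
      trans (+-cong (sumTo-zero j _ (λ k k<j → trans (*-congˡ (reflexive (𝖽-far k (suc j) (s≤s k<j)))) (zeroʳ _)))
                    (trans (*-congˡ (reflexive (𝖽-super j))) (*-identityʳ _)))
            (+-identityˡ _)

  first-row-vanishes : ∀ N j → N < j → ⟨W|𝖽^ N |V^ j ⟩ ≈ 0#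
  first-row-vanishes zero    (suc j) _         = reflexive (𝟙-off-diagonal j)
    where
    𝟙-off-diagonal : ∀ j → 𝟙 0 (suc j) ≡ 0#
    𝟙-off-diagonal j with 0 ≟ suc j
    ... | no _ = ≡.refl
  first-row-vanishes (suc N) (suc j) (s≤s N<j) = begin
    ⟨W|𝖽^ suc N |V^ suc j ⟩
      ≈⟨ first-row-recurrence N (suc j) ⟩
    ⟨W|𝖽^ N |V^ j ⟩ + ⟨W|𝖽^ N |V^ suc j ⟩ * d♮ (suc j) + ⟨W|𝖽^ N |V^ 2 +ℕ j ⟩ * d♭ (suc j)
      ≈⟨ +-cong (+-cong (first-row-vanishes N j N<j)
                        (*-congʳ (first-row-vanishes N (suc j) (ℕ.m<n⇒m<1+n N<j))))
                (*-congʳ (first-row-vanishes N (2 +ℕ j) (ℕ.m<n⇒m<1+n (ℕ.m<n⇒m<1+n N<j)))) ⟩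
    0# + 0# * d♮ (suc j) + 0# * d♭ (suc j)
      ≈⟨ solve 2 (λ x y → Κ 0ℤ ⊕ Κ 0ℤ ⊗ x ⊕ Κ 0ℤ ⊗ y ⊜ Κ 0ℤ) refl (d♮ (suc j)) (d♭ (suc j)) ⟩
    0# ∎

  first-row : ∀ N m r → m +ℕ r ≡ N → ⟨W|𝖽^ N |V^ r ⟩ ≈ closedForm m r
  first-row zero    zero    zero    _      = sym (closedForm-zeroˡ 0)
  first-row (suc N) zero    (suc j) ≡.refl = begin
    ⟨W|𝖽^ suc N |V^ suc j ⟩
      ≈⟨ first-row-recurrence N (suc j) ⟩
    ⟨W|𝖽^ N |V^ j ⟩ + ⟨W|𝖽^ N |V^ suc j ⟩ * d♮ (suc j) + ⟨W|𝖽^ N |V^ 2 +ℕ j ⟩ * d♭ (suc j)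
      ≈⟨ +-cong (+-cong (trans (first-row N 0 j ≡.refl) (closedForm-zeroˡ j))
                        (*-congʳ (first-row-vanishes N (suc j) (ℕ.n<1+n N))))
                (*-congʳ (first-row-vanishes N (2 +ℕ j) (ℕ.m<n⇒m<1+n (ℕ.n<1+n N)))) ⟩
    1# + 0# * d♮ (suc j) + 0# * d♭ (suc j)
      ≈⟨ solve 2 (λ x y → Κ 1ℤ ⊕ Κ 0ℤ ⊗ x ⊕ Κ 0ℤ ⊗ y ⊜ Κ 1ℤ) refl (d♮ (suc j)) (d♭ (suc j)) ⟩
    1#
      ≈⟨ closedForm-zeroˡ (suc j) ⟨
    closedForm 0 (suc j) ∎
  first-row (suc N) (suc m) r 1+m+r≡1+N = begin
    ⟨W|𝖽^ suc N |V^ r ⟩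
      ≈⟨ first-row-recurrence N r ⟩
    previousEntry N r + ⟨W|𝖽^ N |V^ r ⟩ * d♮ r + ⟨W|𝖽^ N |V^ suc r ⟩ * d♭ r
      ≈⟨ +-cong (+-cong (previousEntry≈ r m+r≡N) (*-congʳ (first-row N m r m+r≡N)))
                (*-congʳ (nextEntry≈ m m+r≡N)) ⟩
    previousColumn m r + closedForm m r * d♮ r + nextColumn m r * d♭ r
      ≈⟨ closedForm-recurrence m r ⟨
    closedForm (suc m) r ∎
    where
    m+r≡N : m +ℕ r ≡ N
    m+r≡N = ℕ.suc-injective 1+m+r≡1+N

    previousEntry≈ : ∀ r → m +ℕ r ≡ N → previousEntry N r ≈ previousColumn m r
    previousEntry≈ zero    _  = refl
    previousEntry≈ (suc j) eq = first-row N (suc m) j (≡.trans (≡.sym (ℕ.+-suc m j)) eq)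

    nextEntry≈ : ∀ m → m +ℕ r ≡ N → ⟨W|𝖽^ N |V^ suc r ⟩ ≈ nextColumn m r
    nextEntry≈ zero    ≡.refl = first-row-vanishes r (suc r) (ℕ.n<1+n r)
    nextEntry≈ (suc k) k+r≡N  = first-row N k (suc r) (≡.trans (ℕ.+-suc k r) k+r≡N)

theorem7p13 : ∀ {c ℓ : Level} (K : Field c ℓ) (a b c d q : Field.Carrier K)
    → Setup.Generic K a b c d q
    → ∀ (m r : ℕ)
    → Field._≈_ K
        (Setup.⟨W|𝖽^_|V^_⟩ K a b c d q (m +ℕ r) r)
        (Field._*_ K (Setup.qbinom K a b c d q (m +ℕ r) r)
          (Setup._/_ K a b c d q
            (Setup.F K a b c d q m (Field._*_ K (Field._*_ K b d) (Setup.qn K a b c d q r)))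
            (Setup.prodTo K a b c d q m
              (λ i → Setup._−_ K a b c d q (Field.1# K)
                 (Field._*_ K (Setup.abcd K a b c d q) (Setup.qn K a b c d q (2 *ℕ r +ℕ i)))))))
theorem7p13 K a b c d q generic m r = Development.first-row K a b c d q generic (m +ℕ r) m r ≡.refl
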